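{- Let $n\geqslant 1$, let $w,w'\in S_n$, and let $\alpha=\mathsf{code}(w)$, $\alpha'=\mathsf{code}(w')$. Then $w$ covers $w'$ in the (strong) Bruhat order with $w'=w\cdot(i,j)$ (where $i<j$) if and only if $\alpha$ covers $\alpha'$ in positions $(i,j)$.
   Context: Notation: $[n]=\{1,\dots,n\}$ and $[a,b]=\{a,a+1,\dots,b\}$ for integers $a\leqslant b$. $S_n$ is the symmetric group, generated by the simple transpositions $s_i=(i,i+1)$, $i\in[n-1]$; $\ell(w)$ is the length (minimal number of simple transpositions in a product equal to $w$, equivalently the number of inversions). Permutations are written in one-line notation $w=w(1)w(2)\cdots w(n)$, and $w\cdot(i,j)$ denotes right multiplication by the transposition $(i,j)$, i.e. the permutation obtained from $w$ by swapping the values in positions $i$ and $j$. The (strong) Bruhat order: $u\leqslant w$ if, for a reduced decomposition $w=s_{j_1}\cdots s_{j_r}$, $u$ equals a product of a subword $s_{j_{i_1}}\cdots s_{j_{i_k}}$ with $i_1<\dots<i_k$. $w$ covers $w'$ if $w'\leqslant w$ and $\ell(w)=\ell(w')+1$. A (weak) composition is a finite sequence $\alpha=(\alpha_1,\dots,\alpha_m)$ of nonnegative integers, with the convention $\alpha_k=0$ for $k>m$; its weight is $|\alpha|=\sum_k\alpha_k$. The code of $w\in S_n$ is $\mathsf{code}(w)=(\alpha_1,\dots,\alpha_{n-1})$ with $\alpha_i=\#\{k>i : w(k)<w(i)\}$. For a composition $\alpha$, a positive integer $i$ and $j\in\mathbb{N}$, define $c_{i,j}(\alpha)$ recursively in $j$: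 $c_{i,j}(\alpha)=0$ if $j\leqslant i+1$; and for $j>i+1$, $c_{i,j}(\alpha)=c_{i,j-1}(\alpha)+1$ if $\alpha_{j-1}<\alpha_i-c_{i,j-1}(\alpha)$, and $c_{i,j}(\alpha)=c_{i,j-1}(\alpha)$ if $\alpha_{j-1}\geqslant\alpha_i-c_{i,j-1}(\alpha)$. Given compositions $\alpha,\alpha'$ with $|\alpha|=|\alpha'|+1$, we say $\alpha$ covers $\alpha'$ in positions $(i,j)$, where $i<j$ are positive integers, if: (a1) $\alpha'_i\leqslant\alpha_i-1$; (a2) $\alpha'_j=\alpha_j+\alpha_i-\alpha'_i-1$; (a3) $\alpha'_k=\alpha_k$ for all $k\neq i,j$; (a4) $c_{i,j}(\alpha)=c_{i,j}(\alpha')=\alpha'_i-\alpha_j$. -}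

module Defs where

open import Data.Nat using (ℕ; zero; suc; _+_; _∸_; _≤_; _<_; _<?_; _≤?_)
open import Data.Fin using (Fin; toℕ; inject₁) renaming (suc to fsuc)
open import Data.Fin.Permutation using (Permutation′; _⟨$⟩ʳ_; _≈_; _∘ₚ_; transpose; id)
open import Data.List using (List; []; _∷_; length; filter; map; allFin; cartesianProduct)
open import Data.Nat.ListAction using (sum)
open import Data.List.Relation.Binary.Sublist.Propositional using (_⊆_)
open import Data.Product using (Σ; _×_; _,_; proj₁; proj₂; ∃)
open import Relation.Nullary.Decidable using (_×-dec_; yes; no)
open import Relation.Binary.PropositionalEquality using (_≡_; _≢_)

-- Permutations of S_n, n = suc m  (so n ≥ 1).  Positions/values 1..n
-- are represented by Fin n as 0..n-1.

-- Product as in the paper: (u · v)(k) = u (v k).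
-- (stdlib: (π₁ ∘ₚ π₂) k = π₂ (π₁ k).)
_·_ : ∀ {n} → Permutation′ n → Permutation′ n → Permutation′ n
u · v = v ∘ₚ u

s : ∀ {m} → Fin m → Permutation′ (suc m)
s a = transpose (inject₁ a) (fsuc a)

prod : ∀ {m} → List (Fin m) → Permutation′ (suc m)
prod []       = id
prod (a ∷ as) = s a · prod as

ℓ : ∀ {n} → Permutation′ n → ℕ
ℓ {n} w = length (filter (λ p → (toℕ (proj₁ p) <? toℕ (proj₂ p))
                           ×-dec (toℕ (w ⟨$⟩ʳ proj₂ p) <? toℕ (w ⟨$⟩ʳ proj₁ p)))
                         (cartesianProduct (allFin n) (allFin n)))

Reduced : ∀ {m} → List (Fin m) → Permutation′ (suc m) → Set
Reduced ws w = (prod ws ≈ w) × (length ws ≡ ℓ w)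

_≤B_ : ∀ {m} → Permutation′ (suc m) → Permutation′ (suc m) → Set
_≤B_ {m} u w = Σ (List (Fin m)) λ ws → Reduced ws w ×
                 Σ (List (Fin m)) λ vs → (vs ⊆ ws) × (prod vs ≈ u)

_Covers_ : ∀ {m} → Permutation′ (suc m) → Permutation′ (suc m) → Set
w Covers w' = (w' ≤B w) × (ℓ w ≡ ℓ w' + 1)

-- Compositions: finite lists of naturals, entries α_1, α_2, ... ;
-- α_k = 0 for k beyond the list.

Composition : Set
Composition = List ℕ

-- α_k (1-indexed, 0 outside the list; index 0 also gives 0, never used)
at : Composition → ℕ → ℕ
at []      _             = 0
at (a ∷ α) zero          = 0
at (a ∷ α) (suc zero)    = a
at (a ∷ α) (suc (suc k)) = at α (suc k)

weight : Composition → ℕ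
weight = sum

codeEntry : ∀ {n} → Permutation′ n → Fin n → ℕ
codeEntry {n} w i = length (filter (λ k → (toℕ i <? toℕ k) ×-dec (toℕ (w ⟨$⟩ʳ k) <? toℕ (w ⟨$⟩ʳ i)))
                                   (allFin n))

code : ∀ {m} → Permutation′ (suc m) → Composition
code {m} w = map (λ i → codeEntry w (inject₁ i)) (allFin m)

c : Composition → ℕ → ℕ → ℕ
c α i zero    = 0
c α i (suc j) with suc j ≤? suc i
... | yes _ = 0
... | no  _ with at α j <? at α i ∸ c α i j
...   | yes _ = suc (c α i j)
...   | no  _ = c α i j

-- α covers α' in positions (i,j)  (i < j positive integers).
-- (a2) and (a4) are written additively; with (a1) and c ≥ 0 they are
-- exactly the integer equations of the paper.
CoversIn : Composition → Composition → ℕ → ℕ → Set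
CoversIn α α' i j =
    (weight α ≡ weight α' + 1)
  × (at α' i + 1 ≤ at α i)                                   -- (a1)
  × (at α' j + at α' i + 1 ≡ at α j + at α i)                -- (a2)
  × (∀ k → 1 ≤ k → k ≢ i → k ≢ j → at α' k ≡ at α k)        -- (a3)
  × (c α i j + at α j ≡ at α' i)                             -- (a4, α)
  × (c α' i j + at α j ≡ at α' i)                            -- (a4, α')

{-# OPTIONS --safe #-}
-- A permutation w of [0, n) is handled as a function W : ℕ → ℕ; code(w)_k counts the later
-- positions holding a smaller value and ℓ(w) is the sum of the code. For positions i < j with
-- W j < W i, let g be the number of positions strictly between i and j whose value lies strictly
-- between W j and W i. Then ℓ(w) = ℓ(w·(i j)) + 2g + 1, and the codes of w and w·(i j) differ
-- only at i, at j and at those g positions; so ℓ drops by exactly one iff g = 0, and then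
-- (a1)–(a4) hold, c_{i,j} on a code counting the positions between i and j with value below W i.
-- Conversely (a1)–(a4) force W j < W i and g = 0 (by running the recursion defining c_{i,j}(α')),
-- and then determine the whole code of w', which determines w'. Finally, if g = 0, a reduced
-- word of w containing a subword for w·(i j) is built by induction on ℓ(w), peeling off an
-- adjacent descent (a a+1) with i ≤ a < j.
module Submission where

open import Defs
open import Data.Nat using (ℕ; suc; _<_; _+_)
open import Data.Fin using (Fin; toℕ)
open import Data.Fin.Permutation using (Permutation′; _≈_; transpose)
open import Data.Product using (_×_)
open import Function.Bundles using (_⇔_)

open import Data.Bool using (true; false; if_then_else_)
open import Data.Fin using (fromℕ<; inject₁) renaming (zero to fzero; suc to fsuc)
import Data.Fin as Fin
import Data.Fin.Permutation as Perm
import Data.Fin.Permutation.Components as PC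
open import Data.Fin.Permutation using (_⟨$⟩ʳ_; _⟨$⟩ˡ_; inverseˡ; inverseʳ)
open import Data.Fin.Properties using (toℕ-fromℕ<; toℕ-injective; toℕ<n; toℕ-inject₁)
open import Data.List using (List; []; _∷_; length; filter; map; tabulate; allFin; cartesianProduct; _++_)
open import Data.List.Properties using (length-++; filter-++; map-tabulate)
open import Data.List.Relation.Binary.Sublist.Propositional using (⊆-refl)
open import Data.List.Relation.Binary.Sublist.Propositional.Properties using (++⁺; ++⁺ʳ)
open import Data.Nat.ListAction using (sum)
open import Data.Nat hiding (ℕ; suc; _<_; _+_)
open import Data.Nat.Properties
open import Data.Nat.Tactic.RingSolver using (solve-∀)
open import Data.Product using (Σ; _,_; proj₁; proj₂)
open import Data.Sum using (_⊎_; inj₁; inj₂)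
open import Function using (_∘_)
open import Function.Bundles using (mk⇔)
open import Relation.Binary.Definitions using (tri<; tri≈; tri>)
open import Relation.Binary.PropositionalEquality hiding ([_])
open import Relation.Nullary using (Dec; yes; no; ¬_; contradiction; does)
open import Relation.Nullary.Decidable using (dec-true; dec-false; _×-dec_)
open import Relation.Unary using (Pred; Decidable)

∑ : (ℕ → ℕ) → ℕ → ℕ → ℕ
∑ f a zero = 0
∑ f a (suc b) with a ≤? b
... | yes _ = ∑ f a b + f b
... | no _ = ∑ f a b

∑-extend : ∀ f {a b} → a ≤ b → ∑ f a (suc b) ≡ ∑ f a b + f b
∑-extend f {a} {b} a≤b with a ≤? b
... | yes _ = refl
... | no a≰b = contradiction a≤b a≰b

∑-empty : ∀ f {a} b → b ≤ a → ∑ f a b ≡ 0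
∑-empty f zero _ = refl
∑-empty f {a} (suc b) b<a with a ≤? b
... | yes a≤b = contradiction a≤b (<⇒≱ b<a)
... | no _ = ∑-empty f b (<⇒≤ b<a)

∑-split : ∀ f {a b} c → a ≤ b → b ≤ c → ∑ f a c ≡ ∑ f a b + ∑ f b c
∑-split f {a} {b} c a≤b b≤c with m≤n⇒m<n∨m≡n b≤c
... | inj₂ refl = sym (trans (cong (∑ f a b +_) (∑-empty f b ≤-refl)) (+-identityʳ _))
∑-split f {a} {b} (suc c) a≤b b≤c | inj₁ b<1+c = begin
    ∑ f a (suc c)         ≡⟨ ∑-extend f (≤-trans a≤b b≤c′) ⟩
    ∑ f a c + f c         ≡⟨ cong (_+ f c) (∑-split f c a≤b b≤c′) ⟩
    ∑ f a b + ∑ f b c + f c   ≡⟨ +-assoc (∑ f a b) _ _ ⟩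
    ∑ f a b + (∑ f b c + f c) ≡⟨ cong (∑ f a b +_) (sym (∑-extend f b≤c′)) ⟩
    ∑ f a b + ∑ f b (suc c) ∎
  where
  open ≡-Reasoning
  b≤c′ : b ≤ c
  b≤c′ = ≤-pred b<1+c

∑-head : ∀ f {a b} → a < b → ∑ f a b ≡ f a + ∑ f (suc a) b
∑-head f {a} {b} a<b = begin
  ∑ f a b                     ≡⟨ ∑-split f b (n≤1+n a) a<b ⟩
  ∑ f a (suc a) + ∑ f (suc a) b ≡⟨ cong (_+ ∑ f (suc a) b) (∑-extend f ≤-refl) ⟩
  ∑ f a a + f a + ∑ f (suc a) b ≡⟨ cong (λ t → t + f a + ∑ f (suc a) b) (∑-empty f a ≤-refl) ⟩
  f a + ∑ f (suc a) b ∎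
  where open ≡-Reasoning

∑-pick : ∀ f {a k b} → a ≤ k → k < b → ∑ f a b ≡ ∑ f a k + (f k + ∑ f (suc k) b)
∑-pick f {a} {k} {b} a≤k k<b = trans (∑-split f b a≤k (<⇒≤ k<b)) (cong (∑ f a k +_) (∑-head f k<b))

∑-pick₂ : ∀ f {a i j b} → a ≤ i → i < j → j < b →
          ∑ f a b ≡ ∑ f a i + (f i + (∑ f (suc i) j + (f j + ∑ f (suc j) b)))
∑-pick₂ f {a} {i} a≤i i<j j<b =
  trans (∑-pick f a≤i (<-trans i<j j<b)) (cong (λ t → ∑ f a i + (f i + t)) (∑-pick f i<j j<b))

∑-cong : ∀ f g {a} b → (∀ k → a ≤ k → k < b → f k ≡ g k) → ∑ f a b ≡ ∑ g a b
∑-cong f g zero f≗g = refl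
∑-cong f g {a} (suc b) f≗g with a ≤? b
... | yes a≤b = cong₂ _+_ (∑-cong f g b (λ k a≤k k<b → f≗g k a≤k (m≤n⇒m≤1+n k<b))) (f≗g b a≤b ≤-refl)
... | no _ = ∑-cong f g b (λ k a≤k k<b → f≗g k a≤k (m≤n⇒m≤1+n k<b))

∑-zeros : ∀ a b → ∑ (λ _ → 0) a b ≡ 0
∑-zeros a zero = refl
∑-zeros a (suc b) with a ≤? b
... | yes _ = trans (+-identityʳ _) (∑-zeros a b)
... | no _ = ∑-zeros a b

∑-mono-≤ : ∀ f g {a} b → (∀ k → a ≤ k → k < b → f k ≤ g k) → ∑ f a b ≤ ∑ g a b
∑-mono-≤ f g zero f≤g = z≤n
∑-mono-≤ f g {a} (suc b) f≤g with a ≤? b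
... | yes a≤b = +-mono-≤ (∑-mono-≤ f g b (λ k a≤k k<b → f≤g k a≤k (m≤n⇒m≤1+n k<b))) (f≤g b a≤b ≤-refl)
... | no _ = ∑-mono-≤ f g b (λ k a≤k k<b → f≤g k a≤k (m≤n⇒m≤1+n k<b))

∑-mono-< : ∀ f g {a} b k → (∀ k → a ≤ k → k < b → f k ≤ g k) → a ≤ k → k < b → f k < g k → ∑ f a b < ∑ g a b
∑-mono-< f g {a} b k f≤g a≤k k<b fk<gk = begin-strict
    ∑ f a b                                  ≡⟨ ∑-pick f a≤k k<b ⟩
    ∑ f a k + (f k + ∑ f (suc k) b)          <⟨ +-monoʳ-< (∑ f a k) (+-mono-<-≤ fk<gk (∑-mono-≤ f g b (λ l k<l l<b → f≤g l (≤-trans a≤k (<⇒≤ k<l)) l<b))) ⟩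
    ∑ f a k + (g k + ∑ g (suc k) b)          ≤⟨ +-monoˡ-≤ _ (∑-mono-≤ f g k (λ l a≤l l<k → f≤g l a≤l (<-trans l<k k<b))) ⟩
    ∑ g a k + (g k + ∑ g (suc k) b)          ≡⟨ sym (∑-pick g a≤k k<b) ⟩
    ∑ g a b ∎
  where open ≤-Reasoning

∑-+ : ∀ f g {a} b → ∑ (λ k → f k + g k) a b ≡ ∑ f a b + ∑ g a b
∑-+ f g zero = refl
∑-+ f g {a} (suc b) with a ≤? b
... | yes _ = trans (cong (_+ (f b + g b)) (∑-+ f g b)) (interchange (∑ f a b) (∑ g a b) (f b) (g b))
  where
  interchange : ∀ x y z w → x + y + (z + w) ≡ x + z + (y + w)
  interchange = solve-∀
... | no _ = ∑-+ f g b

∑-shift : ∀ f a b → ∑ f (suc a) (suc b) ≡ ∑ (f ∘ suc) a b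
∑-shift f a zero = ∑-empty f {suc a} 1 (s≤s z≤n)
∑-shift f a (suc b) with a ≤? b
... | yes a≤b = trans (∑-extend f (s≤s a≤b)) (cong (_+ f (suc b)) (∑-shift f a b))
... | no a≰b = trans (∑-empty-step (s≤s (≰⇒> a≰b))) (∑-shift f a b)
  where
  ∑-empty-step : suc (suc b) ≤ suc a → ∑ f (suc a) (suc (suc b)) ≡ ∑ f (suc a) (suc b)
  ∑-empty-step b<a with suc a ≤? suc b
  ... | yes a≤b = contradiction a≤b (<⇒≱ b<a)
  ... | no _ = refl

∑≡0⇒ : ∀ f {a} b → ∑ f a b ≡ 0 → ∀ k → a ≤ k → k < b → f k ≡ 0
∑≡0⇒ f {a} b ∑≡0 k a≤k k<b = m+n≡0⇒m≡0 (f k) (m+n≡0⇒n≡0 (∑ f a k) (trans (sym (∑-pick f a≤k k<b)) ∑≡0))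

∑≢0⇒ : ∀ f a b → ∑ f a b ≢ 0 → Σ ℕ λ k → a ≤ k × k < b × f k ≢ 0
∑≢0⇒ f a zero ∑≢0 = contradiction refl ∑≢0
∑≢0⇒ f a (suc b) ∑≢0 with b <? a
... | yes b<a = contradiction (∑-empty f (suc b) b<a) ∑≢0
... | no b≮a with a≤b ← ≮⇒≥ b≮a | f b ≟ 0
...   | no fb≢0 = b , a≤b , ≤-refl , fb≢0
...   | yes fb≡0 with ∑≢0⇒ f a b (λ ∑≡0 → ∑≢0 (trans (∑-extend f a≤b) (cong₂ _+_ ∑≡0 fb≡0)))
...     | k , a≤k , k<b , fk≢0 = k , a≤k , m≤n⇒m≤1+n k<b , fk≢0

[_<_] : ℕ → ℕ → ℕ
[ x < y ] = if does (x <? y) then 1 else 0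

<⇒[<]≡1 : ∀ {x y} → x < y → [ x < y ] ≡ 1
<⇒[<]≡1 {x} {y} x<y = cong (if_then 1 else 0) (dec-true (x <? y) x<y)

≮⇒[<]≡0 : ∀ {x y} → ¬ x < y → [ x < y ] ≡ 0
≮⇒[<]≡0 {x} {y} x≮y = cong (if_then 1 else 0) (dec-false (x <? y) x≮y)

[<]-monoʳ-≤ : ∀ z {x y} → x ≤ y → [ z < x ] ≤ [ z < y ]
[<]-monoʳ-≤ z {x} {y} x≤y with z <? x
... | yes z<x = ≤-reflexive (trans (<⇒[<]≡1 z<x) (sym (<⇒[<]≡1 (<-≤-trans z<x x≤y))))
... | no z≮x = subst (_≤ [ z < y ]) (sym (≮⇒[<]≡0 z≮x)) z≤n

between : ℕ → ℕ → ℕ → ℕ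
between lo hi x = [ lo < x ] * [ x < hi ]

[<]-widenʳ : ∀ x {t₁ t₂} → x ≢ t₁ → t₁ < t₂ → [ x < t₂ ] ≡ [ x < t₁ ] + between t₁ t₂ x
[<]-widenʳ x {t₁} {t₂} x≢t₁ t₁<t₂ with <-cmp x t₁
... | tri< x<t₁ _ _
  rewrite <⇒[<]≡1 x<t₁ | <⇒[<]≡1 (<-trans x<t₁ t₁<t₂) | ≮⇒[<]≡0 (<-asym x<t₁) = refl
... | tri≈ _ x≡t₁ _ = contradiction x≡t₁ x≢t₁
... | tri> _ _ t₁<x with x <? t₂
...   | yes x<t₂ rewrite <⇒[<]≡1 x<t₂ | <⇒[<]≡1 t₁<x | ≮⇒[<]≡0 (<-asym t₁<x) = refl
...   | no x≮t₂ rewrite ≮⇒[<]≡0 x≮t₂ | <⇒[<]≡1 t₁<x | ≮⇒[<]≡0 (<-asym t₁<x) = refl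

[<]-widenˡ : ∀ x {t₁ t₂} → x ≢ t₂ → t₁ < t₂ → [ t₁ < x ] ≡ [ t₂ < x ] + between t₁ t₂ x
[<]-widenˡ x {t₁} {t₂} x≢t₂ t₁<t₂ with <-cmp x t₂
... | tri> _ _ t₂<x
  rewrite <⇒[<]≡1 t₂<x | <⇒[<]≡1 (<-trans t₁<t₂ t₂<x) | ≮⇒[<]≡0 (<-asym t₂<x) = refl
... | tri≈ _ x≡t₂ _ = contradiction x≡t₂ x≢t₂
... | tri< x<t₂ _ _ with t₁ <? x
...   | yes t₁<x rewrite <⇒[<]≡1 t₁<x | <⇒[<]≡1 x<t₂ | ≮⇒[<]≡0 (<-asym x<t₂) = refl
...   | no t₁≮x rewrite ≮⇒[<]≡0 t₁≮x | ≮⇒[<]≡0 (<-asym x<t₂) = refl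

[_≡_] : ℕ → ℕ → ℕ
[ x ≡ y ] = if does (x ≟ y) then 1 else 0

≡⇒[≡]≡1 : ∀ {x y} → x ≡ y → [ x ≡ y ] ≡ 1
≡⇒[≡]≡1 {x} {y} x≡y = cong (if_then 1 else 0) (dec-true (x ≟ y) x≡y)

≢⇒[≡]≡0 : ∀ {x y} → x ≢ y → [ x ≡ y ] ≡ 0
≢⇒[≡]≡0 {x} {y} x≢y = cong (if_then 1 else 0) (dec-false (x ≟ y) x≢y)

[<]-suc : ∀ x y → [ x < suc y ] ≡ [ x < y ] + [ x ≡ y ]
[<]-suc x y with <-cmp x y
... | tri< x<y _ _ rewrite <⇒[<]≡1 x<y | <⇒[<]≡1 (m≤n⇒m≤1+n x<y) | ≢⇒[≡]≡0 (<⇒≢ x<y) = refl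
... | tri≈ _ refl _ rewrite ≮⇒[<]≡0 (n≮n x) | <⇒[<]≡1 (n<1+n x) | ≡⇒[≡]≡1 (refl {x = x}) = refl
... | tri> _ _ y<x rewrite ≮⇒[<]≡0 (<-asym y<x) | ≢⇒[≡]≡0 (<⇒≢ y<x ∘ sym) | ≮⇒[<]≡0 (<⇒≱ y<x ∘ ≤-pred) = refl

record IsPermutation (n : ℕ) (W : ℕ → ℕ) : Set where
  field
    bounded    : ∀ k → k < n → W k < n
    injective  : ∀ p q → p < n → q < n → W p ≡ W q → p ≡ q
    surjective : ∀ v → v < n → Σ ℕ λ k → k < n × W k ≡ v

countBelow : (ℕ → ℕ) → ℕ → ℕ → ℕ → ℕ
countBelow W t a b = ∑ (λ l → [ W l < t ]) a b

codeAt : ℕ → (ℕ → ℕ) → ℕ → ℕ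
codeAt n W k = countBelow W (W k) (suc k) n

swap : ℕ → ℕ → ℕ → ℕ
swap a b k with k ≟ a
... | yes _ = b
... | no _ with k ≟ b
...   | yes _ = a
...   | no _ = k

swap-first : ∀ a b → swap a b a ≡ b
swap-first a b with a ≟ a
... | yes _ = refl
... | no a≢a = contradiction refl a≢a

swap-second : ∀ a b → swap a b b ≡ a
swap-second a b with b ≟ a
... | yes refl = refl
... | no _ with b ≟ b
...   | yes _ = refl
...   | no b≢b = contradiction refl b≢b

swap-other : ∀ a b k → k ≢ a → k ≢ b → swap a b k ≡ k
swap-other a b k k≢a k≢b with k ≟ a
... | yes k≡a = contradiction k≡a k≢a
... | no _ with k ≟ b
...   | yes k≡b = contradiction k≡b k≢b
...   | no _ = refl

swap-involutive : ∀ a b k → swap a b (swap a b k) ≡ k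
swap-involutive a b k with k ≟ a
... | yes refl = swap-second k b
... | no k≢a with k ≟ b
...   | yes refl = swap-first a k
...   | no k≢b = swap-other a b k k≢a k≢b

swap-< : ∀ {n} a b k → a < n → b < n → k < n → swap a b k < n
swap-< a b k a<n b<n k<n with k ≟ a
... | yes _ = b<n
... | no _ with k ≟ b
...   | yes _ = a<n
...   | no _ = k<n

swap-injective : ∀ a b {p q} → swap a b p ≡ swap a b q → p ≡ q
swap-injective a b {p} {q} eq =
  trans (sym (swap-involutive a b p)) (trans (cong (swap a b) eq) (swap-involutive a b q))

swap-conjugate : ∀ a b x y k → swap a b (swap (swap a b x) (swap a b y) (swap a b k)) ≡ swap x y k
swap-conjugate a b x y k = conjugate (k ≟ x) (k ≟ y)
  where
  conjugate : Dec (k ≡ x) → Dec (k ≡ y) → swap a b (swap (swap a b x) (swap a b y) (swap a b k)) ≡ swap x y k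
  conjugate (yes refl) _ = trans (cong (swap a b) (swap-first (swap a b k) (swap a b y)))
                                 (trans (swap-involutive a b y) (sym (swap-first k y)))
  conjugate (no _) (yes refl) = trans (cong (swap a b) (swap-second (swap a b x) (swap a b k)))
                                      (trans (swap-involutive a b x) (sym (swap-second x k)))
  conjugate (no k≢x) (no k≢y) =
    trans (cong (swap a b) (swap-other _ _ _ (k≢x ∘ swap-injective a b) (k≢y ∘ swap-injective a b)))
          (trans (swap-involutive a b k) (sym (swap-other x y k k≢x k≢y)))

swap∘IsPermutation : ∀ {n W} → IsPermutation n W → ∀ {i j} → i < n → j < n → IsPermutation n (W ∘ swap i j)
swap∘IsPermutation {n} {W} P {i} {j} i<n j<n = record
  { bounded    = λ k k<n → bounded _ (swap-< i j k i<n j<n k<n)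
  ; injective  = λ p q p<n q<n eq → swap-injective i j (injective _ _ (swap-< i j p i<n j<n p<n) (swap-< i j q i<n j<n q<n) eq)
  ; surjective = λ v v<n → let (k , k<n , Wk≡v) = surjective v v<n in
                 swap i j k , swap-< i j k i<n j<n k<n , trans (cong W (swap-involutive i j k)) Wk≡v
  }
  where open IsPermutation P

countBelow-mono : ∀ W {t t′} a b → t ≤ t′ → countBelow W t a b ≤ countBelow W t′ a b
countBelow-mono W a b t≤t′ = ∑-mono-≤ _ _ b (λ l _ _ → [<]-monoʳ-≤ (W l) t≤t′)

countBelow<codeAt : ∀ n W {q r} → q < r → r < n → W r < W q → countBelow W (W r) (suc q) n < codeAt n W q
countBelow<codeAt n W {q} {r} q<r r<n Wr<Wq =
  ∑-mono-< _ _ n r (λ l _ _ → [<]-monoʳ-≤ (W l) (<⇒≤ Wr<Wq)) q<r r<n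
           (subst₂ _<_ (sym (≮⇒[<]≡0 (n≮n (W r)))) (sym (<⇒[<]≡1 Wr<Wq)) z<s)

c-≤ : ∀ α {i j} → j ≤ i → c α i (suc j) ≡ 0
c-≤ α {i} {j} j≤i with suc j ≤? suc i
... | yes _ = refl
... | no j≰i = contradiction (s≤s j≤i) j≰i

c-step-< : ∀ α {i j} → i < j → at α j < at α i ∸ c α i j → c α i (suc j) ≡ suc (c α i j)
c-step-< α {i} {j} i<j αj<rest with suc j ≤? suc i
... | yes j≤i = contradiction (≤-pred j≤i) (<⇒≱ i<j)
... | no _ with at α j <? at α i ∸ c α i j
...   | yes _ = refl
...   | no αj≮rest = contradiction αj<rest αj≮rest

c-step-≥ : ∀ α {i j} → i < j → ¬ (at α j < at α i ∸ c α i j) → c α i (suc j) ≡ c α i j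
c-step-≥ α {i} {j} i<j αj≮rest with suc j ≤? suc i
... | yes j≤i = contradiction (≤-pred j≤i) (<⇒≱ i<j)
... | no _ with at α j <? at α i ∸ c α i j
...   | yes αj<rest = contradiction αj<rest αj≮rest
...   | no _ = refl

module TranspositionCode (n : ℕ) (W V : ℕ → ℕ) (P : IsPermutation n W) (i j : ℕ) (i<j : i < j) (j<n : j < n)
                         (Wj<Wi : W j < W i) (V≗W∘swap : ∀ k → k < n → V k ≡ W (swap i j k)) where
  open IsPermutation P

  i<n : i < n
  i<n = <-trans i<j j<n

  V-i : V i ≡ W j
  V-i = trans (V≗W∘swap i i<n) (cong W (swap-first i j))

  V-j : V j ≡ W i
  V-j = trans (V≗W∘swap j j<n) (cong W (swap-second i j))

  V-other : ∀ k → k < n → k ≢ i → k ≢ j → V k ≡ W k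
  V-other k k<n k≢i k≢j = trans (V≗W∘swap k k<n) (cong W (swap-other i j k k≢i k≢j))

  V-outside : ∀ k → k < n → k < i ⊎ j < k → V k ≡ W k
  V-outside k k<n (inj₁ k<i) = V-other k k<n (<⇒≢ k<i) (<⇒≢ (<-trans k<i i<j))
  V-outside k k<n (inj₂ j<k) = V-other k k<n (<⇒≢ (<-trans i<j j<k) ∘ sym) (<⇒≢ j<k ∘ sym)

  V-inside : ∀ k → i < k → k < j → V k ≡ W k
  V-inside k i<k k<j = V-other k (<-trans k<j j<n) (<⇒≢ i<k ∘ sym) (<⇒≢ k<j)

  betweenAt : ℕ → ℕ
  betweenAt l = between (W j) (W i) (W l)

  gap gapAfter belowWj belowWi : ℕ
  gap      = ∑ betweenAt (suc i) j
  gapAfter = ∑ betweenAt (suc j) n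
  belowWj  = countBelow W (W j) (suc i) j
  belowWi  = countBelow W (W i) (suc i) j

  W≢Wj : ∀ l → l < n → l ≢ j → W l ≢ W j
  W≢Wj l l<n l≢j Wl≡Wj = l≢j (injective l j l<n j<n Wl≡Wj)

  belowWi≡belowWj+gap : belowWi ≡ belowWj + gap
  belowWi≡belowWj+gap =
    trans (∑-cong _ _ j (λ l _ l<j → [<]-widenʳ (W l) (W≢Wj l (<-trans l<j j<n) (<⇒≢ l<j)) Wj<Wi)) (∑-+ _ _ j)

  belowWi-after-j : countBelow W (W i) (suc j) n ≡ codeAt n W j + gapAfter
  belowWi-after-j =
    trans (∑-cong _ _ n (λ l j<l l<n → [<]-widenʳ (W l) (W≢Wj l l<n (<⇒≢ j<l ∘ sym)) Wj<Wi)) (∑-+ _ _ n)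

  codeV-i : codeAt n V i ≡ belowWj + codeAt n W j
  codeV-i = begin
      countBelow V (V i) (suc i) n         ≡⟨ ∑-pick _ i<j j<n ⟩
      countBelow V (V i) (suc i) j + ([ V j < V i ] + countBelow V (V i) (suc j) n)
        ≡⟨ cong₂ _+_ (∑-cong _ _ j (λ l i<l l<j → cong₂ [_<_] (V-inside l i<l l<j) V-i))
                     (cong₂ _+_ (trans (cong₂ [_<_] V-j V-i) (≮⇒[<]≡0 (<-asym Wj<Wi)))
                                (∑-cong _ _ n (λ l j<l l<n → cong₂ [_<_] (V-outside l l<n (inj₂ j<l)) V-i))) ⟩
      belowWj + (0 + codeAt n W j) ∎
    where open ≡-Reasoning

  codeW-i : codeAt n W i ≡ belowWi + suc (codeAt n W j + gapAfter)
  codeW-i = begin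
      codeAt n W i ≡⟨ ∑-pick _ i<j j<n ⟩
      belowWi + ([ W j < W i ] + countBelow W (W i) (suc j) n)
        ≡⟨ cong₂ (λ a b → belowWi + (a + b)) (<⇒[<]≡1 Wj<Wi) belowWi-after-j ⟩
      belowWi + suc (codeAt n W j + gapAfter) ∎
    where open ≡-Reasoning

  codeV-j : codeAt n V j ≡ codeAt n W j + gapAfter
  codeV-j = trans (∑-cong _ _ n (λ l j<l l<n → cong₂ [_<_] (V-outside l l<n (inj₂ j<l)) V-j)) belowWi-after-j

  code-after : ∀ k → j < k → codeAt n V k ≡ codeAt n W k
  code-after k j<k with k <? n
  ... | no k≮n = trans (∑-empty _ n (m≤n⇒m≤1+n (≮⇒≥ k≮n))) (sym (∑-empty _ n (m≤n⇒m≤1+n (≮⇒≥ k≮n))))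
  ... | yes k<n = ∑-cong _ _ n (λ l k<l l<n → cong₂ [_<_] (V-outside l l<n (inj₂ (<-trans j<k k<l)))
                                                           (V-outside k k<n (inj₂ j<k)))

  code-before : ∀ k → k < i → codeAt n V k ≡ codeAt n W k
  code-before k k<i = begin
      countBelow V (V k) (suc k) n         ≡⟨ cong (λ t → countBelow V t (suc k) n) (V-outside k k<n (inj₁ k<i)) ⟩
      ∑ f (suc k) n                        ≡⟨ ∑-pick₂ f k<i i<j j<n ⟩
      ∑ f (suc k) i + (f i + (∑ f (suc i) j + (f j + ∑ f (suc j) n)))
        ≡⟨ cong₂ (λ a b → a + (f i + (b + (f j + ∑ f (suc j) n))))
                 (∑-cong _ _ i (λ l _ l<i → cong [_< W k ] (V-outside l (<-trans l<i i<n) (inj₁ l<i))))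
                 (∑-cong _ _ j (λ l i<l l<j → cong [_< W k ] (V-inside l i<l l<j))) ⟩
      ∑ g (suc k) i + (f i + (∑ g (suc i) j + (f j + ∑ f (suc j) n)))
        ≡⟨ cong (λ c → ∑ g (suc k) i + (f i + (∑ g (suc i) j + (f j + c))))
                (∑-cong _ _ n (λ l j<l l<n → cong [_< W k ] (V-outside l l<n (inj₂ j<l)))) ⟩
      ∑ g (suc k) i + (f i + (∑ g (suc i) j + (f j + ∑ g (suc j) n)))
        ≡⟨ cong₂ (λ a b → ∑ g (suc k) i + (a + (∑ g (suc i) j + (b + ∑ g (suc j) n))))
                 (cong [_< W k ] V-i) (cong [_< W k ] V-j) ⟩
      ∑ g (suc k) i + (g j + (∑ g (suc i) j + (g i + ∑ g (suc j) n)))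
        ≡⟨ exchange (∑ g (suc k) i) (g j) (∑ g (suc i) j) (g i) (∑ g (suc j) n) ⟩
      ∑ g (suc k) i + (g i + (∑ g (suc i) j + (g j + ∑ g (suc j) n)))
        ≡⟨ sym (∑-pick₂ g k<i i<j j<n) ⟩
      codeAt n W k ∎
    where
    open ≡-Reasoning
    k<n : k < n
    k<n = <-trans k<i i<n
    f g : ℕ → ℕ
    f l = [ V l < W k ]
    g l = [ W l < W k ]
    exchange : ∀ a b c d e → a + (b + (c + (d + e))) ≡ a + (d + (c + (b + e)))
    exchange = solve-∀

  code-inside : ∀ k → i < k → k < j → codeAt n W k ≡ codeAt n V k + betweenAt k
  code-inside k i<k k<j = begin
      codeAt n W k ≡⟨ ∑-pick g k<j j<n ⟩
      ∑ g (suc k) j + (g j + ∑ g (suc j) n)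
        ≡⟨ cong (λ t → ∑ g (suc k) j + (t + ∑ g (suc j) n)) (Wj<Wk≡Wi<Wk+between) ⟩
      ∑ g (suc k) j + ([ W i < W k ] + betweenAt k + ∑ g (suc j) n)
        ≡⟨ cong₂ (λ a b → a + ([ b < W k ] + betweenAt k + ∑ g (suc j) n))
                 (∑-cong _ _ j (λ l k<l l<j → cong [_< W k ] (sym (V-inside l (<-trans i<k k<l) l<j))))
                 (sym V-j) ⟩
      ∑ f (suc k) j + (f j + betweenAt k + ∑ g (suc j) n)
        ≡⟨ cong (λ t → ∑ f (suc k) j + (f j + betweenAt k + t))
                (∑-cong _ _ n (λ l j<l l<n → cong [_< W k ] (sym (V-outside l l<n (inj₂ j<l))))) ⟩
      ∑ f (suc k) j + (f j + betweenAt k + ∑ f (suc j) n)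
        ≡⟨ exchange (∑ f (suc k) j) (f j) (betweenAt k) (∑ f (suc j) n) ⟩
      ∑ f (suc k) j + (f j + ∑ f (suc j) n) + betweenAt k
        ≡⟨ cong (_+ betweenAt k) (sym (∑-pick f k<j j<n)) ⟩
      ∑ f (suc k) n + betweenAt k
        ≡⟨ cong (λ t → countBelow V t (suc k) n + betweenAt k) (sym (V-inside k i<k k<j)) ⟩
      codeAt n V k + betweenAt k ∎
    where
    open ≡-Reasoning
    f g : ℕ → ℕ
    f l = [ V l < W k ]
    g l = [ W l < W k ]
    Wj<Wk≡Wi<Wk+between : [ W j < W k ] ≡ [ W i < W k ] + betweenAt k
    Wj<Wk≡Wi<Wk+between =
      [<]-widenˡ (W k) (λ Wk≡Wi → <⇒≢ i<k (sym (injective k i (<-trans k<j j<n) i<n Wk≡Wi))) Wj<Wi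
    exchange : ∀ a b c d → a + (b + c + d) ≡ a + (b + d) + c
    exchange = solve-∀

  ∑code : ∑ (codeAt n W) 0 n ≡ ∑ (codeAt n V) 0 n + suc (gap + gap)
  ∑code = begin
      ∑ cW 0 n ≡⟨ ∑-pick₂ _ z≤n i<j j<n ⟩
      ∑ cW 0 i + (cW i + (∑ cW (suc i) j + (cW j + ∑ cW (suc j) n)))
        ≡⟨ cong₂ (λ a b → a + (cW i + (b + (cW j + ∑ cW (suc j) n))))
                 (∑-cong _ _ i (λ k _ k<i → sym (code-before k k<i)))
                 (trans (∑-cong _ _ j code-inside) (∑-+ _ _ j)) ⟩
      ∑ cV 0 i + (cW i + ((∑ cV (suc i) j + gap) + (cW j + ∑ cW (suc j) n)))
        ≡⟨ cong₂ (λ a b → ∑ cV 0 i + (a + ((∑ cV (suc i) j + gap) + (cW j + b))))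
                 (trans codeW-i (cong (_+ suc (cW j + gapAfter)) belowWi≡belowWj+gap))
                 (∑-cong _ _ n (λ k j<k _ → sym (code-after k j<k))) ⟩
      ∑ cV 0 i + ((belowWj + gap) + suc (cW j + gapAfter) + ((∑ cV (suc i) j + gap) + (cW j + ∑ cV (suc j) n)))
        ≡⟨ regroup (∑ cV 0 i) belowWj gap (cW j) gapAfter (∑ cV (suc i) j) (∑ cV (suc j) n) ⟩
      ∑ cV 0 i + ((belowWj + cW j) + (∑ cV (suc i) j + ((cW j + gapAfter) + ∑ cV (suc j) n))) + suc (gap + gap)
        ≡⟨ cong₂ (λ a b → ∑ cV 0 i + (a + (∑ cV (suc i) j + (b + ∑ cV (suc j) n))) + suc (gap + gap))
                 (sym codeV-i) (sym codeV-j) ⟩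
      ∑ cV 0 i + (cV i + (∑ cV (suc i) j + (cV j + ∑ cV (suc j) n))) + suc (gap + gap)
        ≡⟨ cong (_+ suc (gap + gap)) (sym (∑-pick₂ _ z≤n i<j j<n)) ⟩
      ∑ cV 0 n + suc (gap + gap) ∎
    where
    open ≡-Reasoning
    cW cV : ℕ → ℕ
    cW = codeAt n W
    cV = codeAt n V
    regroup : ∀ s₀ l d c e sᵢ sⱼ → s₀ + ((l + d) + suc (c + e) + ((sᵢ + d) + (c + sⱼ)))
                                   ≡ s₀ + ((l + c) + (sᵢ + ((c + e) + sⱼ))) + suc (d + d)
    regroup = solve-∀

  gap≡0⇒belowWi≡belowWj : gap ≡ 0 → belowWi ≡ belowWj
  gap≡0⇒belowWi≡belowWj gap≡0 = trans belowWi≡belowWj+gap (trans (cong (belowWj +_) gap≡0) (+-identityʳ belowWj))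

  ∑code≡+1⇒gap≡0 : ∑ (codeAt n W) 0 n ≡ ∑ (codeAt n V) 0 n + 1 → gap ≡ 0
  ∑code≡+1⇒gap≡0 eq = m+n≡0⇒m≡0 gap (suc-injective (+-cancelˡ-≡ _ (suc (gap + gap)) 1 (trans (sym ∑code) eq)))

  gap≡0⇒∑code≡+1 : gap ≡ 0 → ∑ (codeAt n W) 0 n ≡ ∑ (codeAt n V) 0 n + 1
  gap≡0⇒∑code≡+1 gap≡0 = trans ∑code (cong (λ g → ∑ (codeAt n V) 0 n + suc (g + g)) gap≡0)

  codeV-i<codeW-i : codeAt n V i + 1 ≤ codeAt n W i
  codeV-i<codeW-i = begin
    codeAt n V i + 1                        ≡⟨ cong (_+ 1) codeV-i ⟩
    belowWj + codeAt n W j + 1              ≤⟨ +-monoˡ-≤ 1 (+-monoˡ-≤ (codeAt n W j) (m≤m+n belowWj gap)) ⟩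
    belowWj + gap + codeAt n W j + 1        ≡⟨ regroup belowWj gap (codeAt n W j) ⟩
    belowWj + gap + suc (codeAt n W j + 0)  ≤⟨ +-monoʳ-≤ (belowWj + gap) (s≤s (+-monoʳ-≤ (codeAt n W j) z≤n)) ⟩
    belowWj + gap + suc (codeAt n W j + gapAfter) ≡⟨ cong (_+ suc (codeAt n W j + gapAfter)) (sym belowWi≡belowWj+gap) ⟩
    belowWi + suc (codeAt n W j + gapAfter) ≡⟨ sym codeW-i ⟩
    codeAt n W i ∎
    where
    open ≤-Reasoning
    regroup : ∀ l d c → l + d + c + 1 ≡ l + d + suc (c + 0)
    regroup = solve-∀

  belowVi+codeW-j≡codeV-i : countBelow V (V i) (suc i) j + codeAt n W j ≡ codeAt n V i
  belowVi+codeW-j≡codeV-i =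
    trans (cong (_+ codeAt n W j) (∑-cong _ _ j (λ l i<l l<j → cong₂ [_<_] (V-inside l i<l l<j) V-i))) (sym codeV-i)

  gap≡0⇒belowWi+codeW-j≡codeV-i : gap ≡ 0 → belowWi + codeAt n W j ≡ codeAt n V i
  gap≡0⇒belowWi+codeW-j≡codeV-i gap≡0 = trans (cong (_+ codeAt n W j) (gap≡0⇒belowWi≡belowWj gap≡0)) (sym codeV-i)

  gap≡0⇒codeV-j+codeV-i : gap ≡ 0 → codeAt n V j + codeAt n V i + 1 ≡ codeAt n W j + codeAt n W i
  gap≡0⇒codeV-j+codeV-i gap≡0 = begin
    codeAt n V j + codeAt n V i + 1 ≡⟨ cong₂ (λ a b → a + b + 1) codeV-j (trans codeV-i (cong (_+ codeAt n W j) (sym (gap≡0⇒belowWi≡belowWj gap≡0)))) ⟩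
    codeAt n W j + gapAfter + (belowWi + codeAt n W j) + 1 ≡⟨ regroup (codeAt n W j) gapAfter belowWi ⟩
    codeAt n W j + (belowWi + suc (codeAt n W j + gapAfter)) ≡⟨ cong (codeAt n W j +_) (sym codeW-i) ⟩
    codeAt n W j + codeAt n W i ∎
    where
    open ≡-Reasoning
    regroup : ∀ c e b → c + e + (b + c) + 1 ≡ c + (b + suc (c + e))
    regroup = solve-∀

  gap≡0⇒codeV-other : gap ≡ 0 → ∀ k → k < n → k ≢ i → k ≢ j → codeAt n V k ≡ codeAt n W k
  gap≡0⇒codeV-other gap≡0 k k<n k≢i k≢j with <-cmp k i | <-cmp k j
  ... | tri< k<i _ _ | _ = code-before k k<i
  ... | tri≈ _ k≡i _ | _ = contradiction k≡i k≢i
  ... | _ | tri≈ _ k≡j _ = contradiction k≡j k≢j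
  ... | _ | tri> _ _ j<k = code-after k j<k
  ... | tri> _ _ i<k | tri< k<j _ _ = sym (trans (code-inside k i<k k<j)
          (trans (cong (codeAt n V k +_) (∑≡0⇒ betweenAt j gap≡0 k i<k k<j)) (+-identityʳ _)))

  -- Scanning q from i+1 to j, the number of values below w(j) in positions ≥ q stays strictly
  -- below α'_i − c_{i,q}(α') as long as gap > 0; at q = j both sides equal code(w)_j.
  module _ (α′ : Composition) (α′-inside : ∀ q → i < q → q < j → at α′ (suc q) ≡ codeAt n W q)
           (α′-i : belowWi + codeAt n W j ≡ at α′ (suc i))
           (c-α′ : c α′ (suc i) (suc j) + codeAt n W j ≡ at α′ (suc i)) where

    belowWj-from : ℕ → ℕ
    belowWj-from q = countBelow W (W j) q n

    remaining : ℕ → ℕ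
    remaining q = at α′ (suc i) ∸ c α′ (suc i) (suc q)

    belowWj-from-j : belowWj-from j ≡ codeAt n W j
    belowWj-from-j = trans (∑-head _ j<n) (cong (_+ codeAt n W j) (≮⇒[<]≡0 (n≮n (W j))))

    belowWj-from-step : ∀ q → i < q → q < j → belowWj-from (suc q) < belowWj-from q ⊎ belowWj-from (suc q) < codeAt n W q
    belowWj-from-step q i<q q<j with <-cmp (W q) (W j)
    ... | tri< Wq<Wj _ _ = inj₁ (≤-reflexive (sym (trans (∑-head _ (<-trans q<j j<n)) (cong (_+ belowWj-from (suc q)) (<⇒[<]≡1 Wq<Wj)))))
    ... | tri≈ _ Wq≡Wj _ = contradiction (injective q j (<-trans q<j j<n) j<n Wq≡Wj) (<⇒≢ q<j)
    ... | tri> _ _ Wj<Wq = inj₂ (countBelow<codeAt n W q<j j<n Wj<Wq)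

    belowWj-from<remaining : 0 < gap → ∀ q → i < q → q ≤ j → belowWj-from q < remaining q
    belowWj-from<remaining 0<gap (suc q) i<1+q 1+q≤j with m≤n⇒m<n∨m≡n (≤-pred i<1+q)
    ... | inj₂ refl = begin-strict
      belowWj-from (suc i)                 ≡⟨ ∑-pick _ i<j j<n ⟩
      belowWj + ([ W j < W j ] + codeAt n W j) ≡⟨ cong (λ t → belowWj + (t + codeAt n W j)) (≮⇒[<]≡0 (n≮n (W j))) ⟩
      belowWj + codeAt n W j               <⟨ +-monoˡ-< (codeAt n W j) (m<m+n belowWj 0<gap) ⟩
      belowWj + gap + codeAt n W j         ≡⟨ cong (_+ codeAt n W j) (sym belowWi≡belowWj+gap) ⟩
      belowWi + codeAt n W j               ≡⟨ α′-i ⟩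
      at α′ (suc i)                        ≡⟨ cong (at α′ (suc i) ∸_) (sym (c-≤ α′ {suc i} ≤-refl)) ⟩
      remaining (suc i) ∎
      where open ≤-Reasoning
    ... | inj₁ i<q with at α′ (suc q) <? remaining q
    ...   | yes α′q<rest =
      subst (belowWj-from (suc q) <_) (sym remaining-step) (suc[m]≤n⇒m≤pred[n] (decrease (belowWj-from-step q i<q q<j)))
      where
      q<j : q < j
      q<j = 1+q≤j
      previous : belowWj-from q < remaining q
      previous = belowWj-from<remaining 0<gap q i<q (<⇒≤ q<j)
      remaining-step : remaining (suc q) ≡ pred (remaining q)
      remaining-step = trans (cong (at α′ (suc i) ∸_) (c-step-< α′ (s≤s i<q) α′q<rest))
                             (sym (pred[m∸n]≡m∸[1+n] (at α′ (suc i)) (c α′ (suc i) (suc q))))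
      decrease : belowWj-from (suc q) < belowWj-from q ⊎ belowWj-from (suc q) < codeAt n W q →
                 suc (belowWj-from (suc q)) < remaining q
      decrease (inj₁ fewer) = <-≤-trans (s≤s fewer) previous
      decrease (inj₂ belowCode) = <-≤-trans (s≤s belowCode) (subst (_< remaining q) (α′-inside q i<q q<j) α′q<rest)
    ...   | no α′q≮rest = begin-strict
      belowWj-from (suc q) ≤⟨ m≤n+m _ [ W q < W j ] ⟩
      [ W q < W j ] + belowWj-from (suc q) ≡⟨ sym (∑-head _ (<-trans 1+q≤j j<n)) ⟩
      belowWj-from q       <⟨ belowWj-from<remaining 0<gap q i<q (<⇒≤ 1+q≤j) ⟩
      remaining q          ≡⟨ cong (at α′ (suc i) ∸_) (sym (c-step-≥ α′ (s≤s i<q) α′q≮rest)) ⟩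
      remaining (suc q) ∎
      where open ≤-Reasoning

    c-α′⇒gap≡0 : gap ≡ 0
    c-α′⇒gap≡0 with gap ≟ 0
    ... | yes gap≡0 = gap≡0
    ... | no gap≢0 = contradiction (belowWj-from<remaining (n≢0⇒n>0 gap≢0) j i<j ≤-refl) (≤⇒≯ (begin
      remaining j                                               ≡⟨ cong (_∸ c α′ (suc i) (suc j)) (sym c-α′) ⟩
      c α′ (suc i) (suc j) + codeAt n W j ∸ c α′ (suc i) (suc j) ≡⟨ m+n∸m≡n (c α′ (suc i) (suc j)) _ ⟩
      codeAt n W j                                              ≡⟨ sym belowWj-from-j ⟩
      belowWj-from j ∎))
      where open ≤-Reasoning

module CodeInjective (n : ℕ) where

  OrderPreserved : (ℕ → ℕ) → (ℕ → ℕ) → ℕ → Set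
  OrderPreserved X Y p = ∀ q r → p ≤ q → q < n → p ≤ r → r < n → X q < X r → Y q < Y r

  SameCode : (ℕ → ℕ) → (ℕ → ℕ) → Set
  SameCode X Y = ∀ k → k < n → codeAt n X k ≡ codeAt n Y k

  [<]-preserved : ∀ {X Y p} → OrderPreserved X Y p → OrderPreserved Y X p →
                  ∀ q r → p ≤ q → q < n → p ≤ r → r < n → [ X q < X r ] ≡ [ Y q < Y r ]
  [<]-preserved {X} {Y} X⇒Y Y⇒X q r p≤q q<n p≤r r<n with X q <? X r
  ... | yes Xq<Xr = trans (<⇒[<]≡1 Xq<Xr) (sym (<⇒[<]≡1 (X⇒Y q r p≤q q<n p≤r r<n Xq<Xr)))
  ... | no Xq≮Xr = trans (≮⇒[<]≡0 Xq≮Xr) (sym (≮⇒[<]≡0 (Xq≮Xr ∘ Y⇒X q r p≤q q<n p≤r r<n)))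

  -- If X p < X r but Y r < Y p, comparing the codes at p against the number of values
  -- below the value at r (which agree, by the order on later positions) gives code X p < code Y p.
  orderPreserved-head : ∀ {X Y} → IsPermutation n Y → SameCode X Y → ∀ p →
                        OrderPreserved X Y (suc p) → OrderPreserved Y X (suc p) →
                        ∀ r → p < r → r < n → X p < X r → Y p < Y r
  orderPreserved-head {X} {Y} PY sameCode p X⇒Y Y⇒X r p<r r<n Xp<Xr with <-cmp (Y p) (Y r)
  ... | tri< Yp<Yr _ _ = Yp<Yr
  ... | tri≈ _ Yp≡Yr _ = contradiction (IsPermutation.injective PY p r (<-trans p<r r<n) r<n Yp≡Yr) (<⇒≢ p<r)
  ... | tri> _ _ Yr<Yp = contradiction (countBelow<codeAt n Y p<r r<n Yr<Yp) (≤⇒≯ (begin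
      codeAt n Y p                  ≡⟨ sym (sameCode p (<-trans p<r r<n)) ⟩
      codeAt n X p                  ≤⟨ countBelow-mono X (suc p) n (<⇒≤ Xp<Xr) ⟩
      countBelow X (X r) (suc p) n  ≡⟨ ∑-cong _ _ n (λ l p<l l<n → [<]-preserved X⇒Y Y⇒X l r p<l l<n p<r r<n) ⟩
      countBelow Y (Y r) (suc p) n  ∎))
    where open ≤-Reasoning

  orderPreserved-step : ∀ {X Y} → IsPermutation n X → IsPermutation n Y → SameCode X Y → ∀ p →
                        OrderPreserved X Y (suc p) → OrderPreserved Y X (suc p) → OrderPreserved X Y p
  orderPreserved-step {X} {Y} PX PY sameCode p X⇒Y Y⇒X q r p≤q q<n p≤r r<n Xq<Xr
    with m≤n⇒m<n∨m≡n p≤q | m≤n⇒m<n∨m≡n p≤r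
  ... | inj₁ p<q | inj₁ p<r = X⇒Y q r p<q q<n p<r r<n Xq<Xr
  ... | inj₂ refl | inj₂ refl = contradiction Xq<Xr (n≮n (X q))
  ... | inj₂ refl | inj₁ p<r = orderPreserved-head PY sameCode p X⇒Y Y⇒X r p<r r<n Xq<Xr
  ... | inj₁ p<q | inj₂ refl with <-cmp (Y q) (Y p)
  ...   | tri< Yq<Yp _ _ = Yq<Yp
  ...   | tri≈ _ Yq≡Yp _ = contradiction (IsPermutation.injective PY q p q<n r<n Yq≡Yp) (<⇒≢ p<q ∘ sym)
  ...   | tri> _ _ Yp<Yq = contradiction Xq<Xr
          (<⇒≯ (orderPreserved-head PX (λ k k<n → sym (sameCode k k<n)) p Y⇒X X⇒Y q p<q q<n Yp<Yq))

  orderPreserved-from : ∀ {X Y} → IsPermutation n X → IsPermutation n Y → SameCode X Y →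
                        ∀ d p → p + d ≡ n → OrderPreserved X Y p × OrderPreserved Y X p
  orderPreserved-from PX PY sameCode zero p p+0≡n = vacuous , vacuous
    where
    vacuous : ∀ {X Y} → OrderPreserved X Y p
    vacuous q _ p≤q q<n _ _ _ = contradiction (≤-trans (≤-reflexive (trans (sym p+0≡n) (+-identityʳ p))) p≤q) (<⇒≱ q<n)
  orderPreserved-from PX PY sameCode (suc d) p p+1+d≡n
    with orderPreserved-from PX PY sameCode d (suc p) (trans (sym (+-suc p d)) p+1+d≡n)
  ... | X⇒Y , Y⇒X = orderPreserved-step PX PY sameCode p X⇒Y Y⇒X
                  , orderPreserved-step PY PX (λ k k<n → sym (sameCode k k<n)) p Y⇒X X⇒Y

∑-indicator : ∀ {n k} → k < n → ∑ (λ l → [ l ≡ k ]) 0 n ≡ 1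
∑-indicator {n} {k} k<n = begin
    ∑ (λ l → [ l ≡ k ]) 0 n ≡⟨ ∑-pick _ z≤n k<n ⟩
    ∑ (λ l → [ l ≡ k ]) 0 k + ([ k ≡ k ] + ∑ (λ l → [ l ≡ k ]) (suc k) n)
      ≡⟨ cong₂ (λ a b → a + ([ k ≡ k ] + b))
               (∑-cong _ _ k (λ l _ l<k → ≢⇒[≡]≡0 (<⇒≢ l<k)))
               (∑-cong _ _ n (λ l k<l _ → ≢⇒[≡]≡0 (<⇒≢ k<l ∘ sym))) ⟩
    ∑ (λ _ → 0) 0 k + ([ k ≡ k ] + ∑ (λ _ → 0) (suc k) n)
      ≡⟨ cong₂ (λ a b → a + (b + ∑ (λ _ → 0) (suc k) n)) (∑-zeros 0 k) (≡⇒[≡]≡1 (refl {x = k})) ⟩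
    suc (∑ (λ _ → 0) (suc k) n) ≡⟨ cong suc (∑-zeros (suc k) n) ⟩
    1 ∎
  where open ≡-Reasoning

countBelow-all : ∀ {n X} → IsPermutation n X → ∀ x → x ≤ n → countBelow X x 0 n ≡ x
countBelow-all {n} {X} P zero _ = trans (∑-cong _ _ n (λ l _ _ → ≮⇒[<]≡0 {X l} {0} λ ())) (∑-zeros 0 n)
countBelow-all {n} {X} P (suc x) x<n with IsPermutation.surjective P x x<n
... | k , k<n , Xk≡x = begin
    countBelow X (suc x) 0 n                                  ≡⟨ ∑-cong _ _ n (λ l _ _ → [<]-suc (X l) x) ⟩
    ∑ (λ l → [ X l < x ] + [ X l ≡ x ]) 0 n                   ≡⟨ ∑-+ _ _ n ⟩
    countBelow X x 0 n + ∑ (λ l → [ X l ≡ x ]) 0 n            ≡⟨ cong₂ _+_ (countBelow-all P x (<⇒≤ x<n)) (∑-cong _ _ n hit) ⟩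
    x + ∑ (λ l → [ l ≡ k ]) 0 n                               ≡⟨ cong (x +_) (∑-indicator k<n) ⟩
    x + 1                                                     ≡⟨ +-comm x 1 ⟩
    suc x ∎
  where
  open ≡-Reasoning
  hit : ∀ l → 0 ≤ l → l < n → [ X l ≡ x ] ≡ [ l ≡ k ]
  hit l _ l<n with l ≟ k
  ... | yes refl = trans (≡⇒[≡]≡1 Xk≡x) (sym (≡⇒[≡]≡1 (refl {x = l})))
  ... | no l≢k = trans (≢⇒[≡]≡0 (l≢k ∘ IsPermutation.injective P l k l<n k<n ∘ λ Xl≡x → trans Xl≡x (sym Xk≡x)))
                       (sym (≢⇒[≡]≡0 l≢k))

code-injective : ∀ {n X Y} → IsPermutation n X → IsPermutation n Y → CodeInjective.SameCode n X Y →
                 ∀ k → k < n → X k ≡ Y k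
code-injective {n} {X} {Y} PX PY sameCode k k<n = begin
    X k                       ≡⟨ sym (countBelow-all PX (X k) (<⇒≤ (IsPermutation.bounded PX k k<n))) ⟩
    countBelow X (X k) 0 n    ≡⟨ ∑-cong _ _ n (λ l _ l<n → [<]-preserved X⇒Y Y⇒X l k z≤n l<n z≤n k<n) ⟩
    countBelow Y (Y k) 0 n    ≡⟨ countBelow-all PY (Y k) (<⇒≤ (IsPermutation.bounded PY k k<n)) ⟩
    Y k ∎
  where
  open ≡-Reasoning
  open CodeInjective n
  X⇒Y : OrderPreserved X Y 0
  X⇒Y = proj₁ (orderPreserved-from PX PY sameCode n 0 refl)
  Y⇒X : OrderPreserved Y X 0
  Y⇒X = proj₂ (orderPreserved-from PX PY sameCode n 0 refl)

-- On the code of a permutation, α_i − c_{i,q}(α) is the number of values below w(i) in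
-- positions ≥ q, so the test α_q < α_i − c_{i,q}(α) holds exactly when w(q) < w(i).
c-code-step : ∀ {n W} → IsPermutation n W → ∀ α → (∀ k → at α (suc k) ≡ codeAt n W k) →
              ∀ {i q} → i < n → i < q → q < n → c α (suc i) (suc q) ≡ countBelow W (W i) (suc i) q →
              c α (suc i) (suc (suc q)) ≡ c α (suc i) (suc q) + [ W q < W i ]
c-code-step {n} {W} P α α≡code {i} {q} i<n i<q q<n previous = byCase (W q <? W i)
  where
  open ≤-Reasoning
  later : ℕ
  later = countBelow W (W i) (suc q) n
  remaining : at α (suc i) ∸ c α (suc i) (suc q) ≡ [ W q < W i ] + later
  remaining = begin-equality
    at α (suc i) ∸ c α (suc i) (suc q)          ≡⟨ cong₂ _∸_ (α≡code i) previous ⟩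
    codeAt n W i ∸ countBelow W (W i) (suc i) q ≡⟨ cong (_∸ countBelow W (W i) (suc i) q) (∑-split _ n i<q (<⇒≤ q<n)) ⟩
    countBelow W (W i) (suc i) q + countBelow W (W i) q n ∸ countBelow W (W i) (suc i) q
                                                ≡⟨ m+n∸m≡n (countBelow W (W i) (suc i) q) _ ⟩
    countBelow W (W i) q n                      ≡⟨ ∑-head _ q<n ⟩
    [ W q < W i ] + later ∎
  byCase : Dec (W q < W i) → c α (suc i) (suc (suc q)) ≡ c α (suc i) (suc q) + [ W q < W i ]
  byCase (yes Wq<Wi) = trans (c-step-< α (s≤s i<q) αq<rest) (trans (+-comm 1 _) (cong (_ +_) (sym (<⇒[<]≡1 Wq<Wi))))
    where
    αq<rest : at α (suc q) < at α (suc i) ∸ c α (suc i) (suc q)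
    αq<rest = begin-strict
      at α (suc q)            ≡⟨ α≡code q ⟩
      codeAt n W q            ≤⟨ countBelow-mono W (suc q) n (<⇒≤ Wq<Wi) ⟩
      later                   <⟨ n<1+n later ⟩
      suc later               ≡⟨ cong (_+ later) (sym (<⇒[<]≡1 Wq<Wi)) ⟩
      [ W q < W i ] + later   ≡⟨ sym remaining ⟩
      at α (suc i) ∸ c α (suc i) (suc q) ∎
  byCase (no Wq≮Wi) = trans (c-step-≥ α (s≤s i<q) rest≤αq) (sym (trans (cong (_ +_) (≮⇒[<]≡0 Wq≮Wi)) (+-identityʳ _)))
    where
    Wi<Wq : W i < W q
    Wi<Wq = ≤∧≢⇒< (≮⇒≥ Wq≮Wi) (<⇒≢ i<q ∘ IsPermutation.injective P i q i<n q<n)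
    rest≤αq : ¬ (at α (suc q) < at α (suc i) ∸ c α (suc i) (suc q))
    rest≤αq = ≤⇒≯ (begin
      at α (suc i) ∸ c α (suc i) (suc q) ≡⟨ remaining ⟩
      [ W q < W i ] + later   ≡⟨ cong (_+ later) (≮⇒[<]≡0 Wq≮Wi) ⟩
      later                   ≤⟨ countBelow-mono W (suc q) n (<⇒≤ Wi<Wq) ⟩
      codeAt n W q            ≡⟨ sym (α≡code q) ⟩
      at α (suc q) ∎)

c-code : ∀ {n W} → IsPermutation n W → ∀ α → (∀ k → at α (suc k) ≡ codeAt n W k) →
         ∀ {i} → i < n → ∀ q → q ≤ n → c α (suc i) (suc q) ≡ countBelow W (W i) (suc i) q
c-code P α α≡code {i} i<n zero _ = c-≤ α {suc i} z≤n
c-code {n} {W} P α α≡code {i} i<n (suc q) q<n with <-cmp i q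
... | tri≈ _ refl _ = trans (c-≤ α {suc i} ≤-refl) (sym (∑-empty _ (suc q) ≤-refl))
... | tri> _ _ q<i = trans (c-≤ α {suc i} (s≤s (<⇒≤ q<i))) (sym (∑-empty _ (suc q) (s≤s (<⇒≤ q<i))))
... | tri< i<q _ _ = begin
    c α (suc i) (suc (suc q))                      ≡⟨ c-code-step P α α≡code i<n i<q q<n previous ⟩
    c α (suc i) (suc q) + [ W q < W i ]            ≡⟨ cong (_+ [ W q < W i ]) previous ⟩
    countBelow W (W i) (suc i) q + [ W q < W i ]   ≡⟨ sym (∑-extend _ i<q) ⟩
    countBelow W (W i) (suc i) (suc q)             ∎
  where
  open ≡-Reasoning
  previous : c α (suc i) (suc q) ≡ countBelow W (W i) (suc i) q
  previous = c-code P α α≡code i<n q (<⇒≤ q<n)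

-- Positions are 0-based here: position k of W is entry α_{k+1}, i.e. at α (suc k).
record CodeOf (n : ℕ) (W : ℕ → ℕ) (α : Composition) : Set where
  field
    at-code     : ∀ k → at α (suc k) ≡ codeAt n W k
    weight-code : weight α ≡ ∑ (codeAt n W) 0 n

NoValueBetween : (ℕ → ℕ) → ℕ → ℕ → Set
NoValueBetween W i j = ∀ k → i < k → k < j → ¬ (W j < W k × W k < W i)

module Cover {n W W′} (PW : IsPermutation n W) (PW′ : IsPermutation n W′)
             {α α′} (α-code : CodeOf n W α) (α′-code : CodeOf n W′ α′)
             {i j} (i<j : i < j) (j<n : j < n) where
  open CodeOf α-code
  open CodeOf α′-code renaming (at-code to at-code′; weight-code to weight-code′)

  i<n : i < n
  i<n = <-trans i<j j<n

  c-α : c α (suc i) (suc j) ≡ countBelow W (W i) (suc i) j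
  c-α = c-code PW α at-code i<n j (<⇒≤ j<n)

  c-α′ : c α′ (suc i) (suc j) ≡ countBelow W′ (W′ i) (suc i) j
  c-α′ = c-code PW′ α′ at-code′ i<n j (<⇒≤ j<n)

  codeAt-≥ : ∀ V k → n ≤ suc k → codeAt n V k ≡ 0
  codeAt-≥ V k n≤1+k = ∑-empty _ n n≤1+k

  at-unchanged : (∀ k → k < n → k ≢ i → k ≢ j → codeAt n W′ k ≡ codeAt n W k) →
                 ∀ k → 1 ≤ k → k ≢ suc i → k ≢ suc j → at α′ k ≡ at α k
  at-unchanged same (suc k) _ k≢i k≢j with k <? n
  ... | yes k<n = trans (at-code′ k) (trans (same k k<n (k≢i ∘ cong suc) (k≢j ∘ cong suc)) (sym (at-code k)))
  ... | no k≮n = trans (at-code′ k) (trans (codeAt-≥ W′ k (m≤n⇒m≤1+n (≮⇒≥ k≮n)))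
                                           (sym (trans (at-code k) (codeAt-≥ W k (m≤n⇒m≤1+n (≮⇒≥ k≮n))))))

  transposition-drop⇒descent : (∀ k → k < n → W′ k ≡ W (swap i j k)) →
                               ∑ (codeAt n W) 0 n ≡ ∑ (codeAt n W′) 0 n + 1 → W j < W i
  transposition-drop⇒descent W′≗W∘swap drop with <-cmp (W j) (W i)
  ... | tri< Wj<Wi _ _ = Wj<Wi
  ... | tri≈ _ Wj≡Wi _ = contradiction (IsPermutation.injective PW j i j<n i<n Wj≡Wi) (<⇒≢ i<j ∘ sym)
  ... | tri> _ _ Wi<Wj = contradiction drop (<⇒≢ (begin-strict
      ∑ (codeAt n W) 0 n                         <⟨ m<m+n _ z<s ⟩
      ∑ (codeAt n W) 0 n + suc (gap + gap)       ≤⟨ m≤m+n _ 1 ⟩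
      ∑ (codeAt n W) 0 n + suc (gap + gap) + 1   ≡⟨ cong (_+ 1) (sym ∑code) ⟩
      ∑ (codeAt n W′) 0 n + 1 ∎))
    where
    open ≤-Reasoning
    W′j<W′i : W′ j < W′ i
    W′j<W′i = subst₂ _<_ (sym (trans (W′≗W∘swap j j<n) (cong W (swap-second i j))))
                         (sym (trans (W′≗W∘swap i i<n) (cong W (swap-first i j)))) Wi<Wj
    W≗W′∘swap : ∀ k → k < n → W k ≡ W′ (swap i j k)
    W≗W′∘swap k k<n = trans (cong W (sym (swap-involutive i j k))) (sym (W′≗W∘swap (swap i j k) (swap-< i j k i<n j<n k<n)))
    open TranspositionCode n W′ W PW′ i j i<j j<n W′j<W′i W≗W′∘swap using (∑code; gap)

  transposition-drop⇒CoversIn : (∀ k → k < n → W′ k ≡ W (swap i j k)) →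
                                ∑ (codeAt n W) 0 n ≡ ∑ (codeAt n W′) 0 n + 1 → CoversIn α α′ (suc i) (suc j)
  transposition-drop⇒CoversIn W′≗W∘swap drop =
    weight-drop , code-i-drop , code-ij , at-unchanged (gap≡0⇒codeV-other gap≡0) , c-α-i , c-α′-i
    where
    Wj<Wi : W j < W i
    Wj<Wi = transposition-drop⇒descent W′≗W∘swap drop
    open TranspositionCode n W W′ PW i j i<j j<n Wj<Wi W′≗W∘swap hiding (i<n)
    gap≡0 : gap ≡ 0
    gap≡0 = ∑code≡+1⇒gap≡0 drop
    weight-drop : weight α ≡ weight α′ + 1
    weight-drop = trans weight-code (trans drop (cong (_+ 1) (sym weight-code′)))
    code-i-drop : at α′ (suc i) + 1 ≤ at α (suc i)
    code-i-drop = subst₂ (λ a b → a + 1 ≤ b) (sym (at-code′ i)) (sym (at-code i)) codeV-i<codeW-i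
    code-ij : at α′ (suc j) + at α′ (suc i) + 1 ≡ at α (suc j) + at α (suc i)
    code-ij = trans (cong₂ (λ a b → a + b + 1) (at-code′ j) (at-code′ i))
                    (trans (gap≡0⇒codeV-j+codeV-i gap≡0) (sym (cong₂ _+_ (at-code j) (at-code i))))
    c-α-i : c α (suc i) (suc j) + at α (suc j) ≡ at α′ (suc i)
    c-α-i = trans (cong₂ _+_ c-α (at-code j)) (trans (gap≡0⇒belowWi+codeW-j≡codeV-i gap≡0) (sym (at-code′ i)))
    c-α′-i : c α′ (suc i) (suc j) + at α (suc j) ≡ at α′ (suc i)
    c-α′-i = trans (cong₂ _+_ c-α′ (at-code j)) (trans belowVi+codeW-j≡codeV-i (sym (at-code′ i)))

  CoversIn⇒descent : CoversIn α α′ (suc i) (suc j) → W j < W i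
  CoversIn⇒descent (_ , code-i-drop , _ , _ , c-α-i , _) with <-cmp (W j) (W i)
  ... | tri< Wj<Wi _ _ = Wj<Wi
  ... | tri≈ _ Wj≡Wi _ = contradiction (IsPermutation.injective PW j i j<n i<n Wj≡Wi) (<⇒≢ i<j ∘ sym)
  ... | tri> _ _ Wi<Wj = contradiction code-i-drop (<⇒≱ (begin-strict
      at α (suc i)                                         ≡⟨ at-code i ⟩
      codeAt n W i                                         ≡⟨ ∑-pick _ i<j j<n ⟩
      belowWi + ([ W j < W i ] + countBelow W (W i) (suc j) n) ≡⟨ cong (λ t → belowWi + (t + countBelow W (W i) (suc j) n)) (≮⇒[<]≡0 (<-asym Wi<Wj)) ⟩
      belowWi + countBelow W (W i) (suc j) n               ≤⟨ +-monoʳ-≤ belowWi (countBelow-mono W (suc j) n (<⇒≤ Wi<Wj)) ⟩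
      belowWi + codeAt n W j                               ≡⟨ cong₂ _+_ (sym c-α) (sym (at-code j)) ⟩
      c α (suc i) (suc j) + at α (suc j)                   ≡⟨ c-α-i ⟩
      at α′ (suc i)                                        <⟨ m<m+n _ z<s ⟩
      at α′ (suc i) + 1 ∎))
    where
    open ≤-Reasoning
    belowWi : ℕ
    belowWi = countBelow W (W i) (suc i) j

  CoversIn⇒∑code-drop : CoversIn α α′ (suc i) (suc j) → ∑ (codeAt n W) 0 n ≡ ∑ (codeAt n W′) 0 n + 1
  CoversIn⇒∑code-drop (weight-drop , _) = trans (sym weight-code) (trans weight-drop (cong (_+ 1) weight-code′))

  CoversIn⇒transposition : (cov : CoversIn α α′ (suc i) (suc j)) →
                           NoValueBetween W i j × (∀ k → k < n → W′ k ≡ W (swap i j k))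
  CoversIn⇒transposition cov@(_ , _ , code-ij , unchanged , c-α-i , c-α′-i) =
    noValueBetween , code-injective PW′ (swap∘IsPermutation PW i<n j<n) sameCode
    where
    open TranspositionCode n W (W ∘ swap i j) PW i j i<j j<n (CoversIn⇒descent cov) (λ _ _ → refl) hiding (i<n)
    at-inside : ∀ k → k < n → k ≢ i → k ≢ j → codeAt n W′ k ≡ codeAt n W k
    at-inside k k<n k≢i k≢j =
      trans (sym (at-code′ k)) (trans (unchanged (suc k) (s≤s z≤n) (k≢i ∘ suc-injective) (k≢j ∘ suc-injective)) (at-code k))
    α′-i : belowWi + codeAt n W j ≡ at α′ (suc i)
    α′-i = trans (cong₂ _+_ (sym c-α) (sym (at-code j))) c-α-i
    gap≡0 : gap ≡ 0
    gap≡0 = c-α′⇒gap≡0 α′ (λ q i<q q<j → trans (at-code′ q) (at-inside q (<-trans q<j j<n) (<⇒≢ i<q ∘ sym) (<⇒≢ q<j)))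
                          α′-i (trans (cong (c α′ (suc i) (suc j) +_) (sym (at-code j))) c-α′-i)
    noValueBetween : NoValueBetween W i j
    noValueBetween k i<k k<j (Wj<Wk , Wk<Wi) = 0≢1+n (trans (sym (∑≡0⇒ betweenAt j gap≡0 k i<k k<j))
                                                            (cong₂ _*_ (<⇒[<]≡1 Wj<Wk) (<⇒[<]≡1 Wk<Wi)))
    code-i : codeAt n W′ i ≡ codeAt n (W ∘ swap i j) i
    code-i = trans (sym (trans α′-i (at-code′ i))) (gap≡0⇒belowWi+codeW-j≡codeV-i gap≡0)
    code-j : codeAt n W′ j ≡ codeAt n (W ∘ swap i j) j
    code-j = +-cancelʳ-≡ _ _ _ (begin
      codeAt n W′ j + (codeAt n W′ i + 1) ≡⟨ sym (+-assoc (codeAt n W′ j) (codeAt n W′ i) 1) ⟩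
      codeAt n W′ j + codeAt n W′ i + 1   ≡⟨ cong₂ (λ a b → a + b + 1) (sym (at-code′ j)) (sym (at-code′ i)) ⟩
      at α′ (suc j) + at α′ (suc i) + 1   ≡⟨ code-ij ⟩
      at α (suc j) + at α (suc i)         ≡⟨ cong₂ _+_ (at-code j) (at-code i) ⟩
      codeAt n W j + codeAt n W i         ≡⟨ sym (gap≡0⇒codeV-j+codeV-i gap≡0) ⟩
      codeAt n (W ∘ swap i j) j + codeAt n (W ∘ swap i j) i + 1   ≡⟨ +-assoc (codeAt n (W ∘ swap i j) j) (codeAt n (W ∘ swap i j) i) 1 ⟩
      codeAt n (W ∘ swap i j) j + (codeAt n (W ∘ swap i j) i + 1) ≡⟨ cong (λ t → codeAt n (W ∘ swap i j) j + (t + 1)) (sym code-i) ⟩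
      codeAt n (W ∘ swap i j) j + (codeAt n W′ i + 1) ∎)
      where open ≡-Reasoning
    sameCode : ∀ k → k < n → codeAt n W′ k ≡ codeAt n (W ∘ swap i j) k
    sameCode k k<n = byPosition (k ≟ i) (k ≟ j)
      where
      byPosition : Dec (k ≡ i) → Dec (k ≡ j) → codeAt n W′ k ≡ codeAt n (W ∘ swap i j) k
      byPosition (yes refl) _ = code-i
      byPosition (no _) (yes refl) = code-j
      byPosition (no k≢i) (no k≢j) = trans (at-inside k k<n k≢i k≢j) (sym (gap≡0⇒codeV-other gap≡0 k k<n k≢i k≢j))

extend : ∀ {n} → (Fin n → ℕ) → ℕ → ℕ
extend {zero} f k = 0
extend {suc n} f zero = f fzero
extend {suc n} f (suc k) = extend (f ∘ fsuc) k

extend-toℕ : ∀ {n} (f : Fin n → ℕ) i → extend f (toℕ i) ≡ f i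
extend-toℕ {suc n} f fzero = refl
extend-toℕ {suc n} f (fsuc i) = extend-toℕ (f ∘ fsuc) i

extend-< : ∀ {n} (f : Fin n → ℕ) {k} (k<n : k < n) → extend f k ≡ f (fromℕ< k<n)
extend-< f {k} k<n = trans (cong (extend f) (sym (toℕ-fromℕ< k<n))) (extend-toℕ f (fromℕ< k<n))

extend-≥ : ∀ {n} (f : Fin n → ℕ) k → n ≤ k → extend f k ≡ 0
extend-≥ {zero} f k _ = refl
extend-≥ {suc n} f (suc k) (s≤s n≤k) = extend-≥ (f ∘ fsuc) k n≤k

extend-inject₁ : ∀ {m} (g : Fin (suc m) → ℕ) k → k < m → extend (g ∘ inject₁) k ≡ extend g k
extend-inject₁ {suc m} g zero _ = refl
extend-inject₁ {suc m} g (suc k) (s≤s k<m) = extend-inject₁ (g ∘ fsuc) k k<m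

∑-from-0-suc : ∀ f n → ∑ f 0 (suc n) ≡ f 0 + ∑ (f ∘ suc) 0 n
∑-from-0-suc f n = trans (∑-head f z<s) (cong (f 0 +_) (∑-shift f 0 n))

sum-tabulate : ∀ {n} (f : Fin n → ℕ) → sum (tabulate f) ≡ ∑ (extend f) 0 n
sum-tabulate {zero} f = refl
sum-tabulate {suc n} f = trans (cong (f fzero +_) (sum-tabulate (f ∘ fsuc))) (sym (∑-from-0-suc (extend f) n))

at-tabulate : ∀ {m} (f : Fin m → ℕ) k → at (tabulate f) (suc k) ≡ extend f k
at-tabulate {zero} f k = refl
at-tabulate {suc m} f zero = refl
at-tabulate {suc m} f (suc k) = at-tabulate (f ∘ fsuc) k

module _ {a p} {A : Set a} {P : Pred A p} (P? : Decidable P) where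

  count : List A → ℕ
  count xs = length (filter P? xs)

  count-∷ : ∀ x xs → count (x ∷ xs) ≡ (if does (P? x) then 1 else 0) + count xs
  count-∷ x xs with does (P? x)
  ... | true = refl
  ... | false = refl

  count-tabulate : ∀ {n} (f : Fin n → A) → count (tabulate f) ≡ ∑ (extend (λ k → if does (P? (f k)) then 1 else 0)) 0 n
  count-tabulate {zero} f = refl
  count-tabulate {suc n} f =
    trans (count-∷ (f fzero) _) (trans (cong (_ +_) (count-tabulate (f ∘ fsuc))) (sym (∑-from-0-suc _ n)))

count-map : ∀ {a b p} {A : Set a} {B : Set b} {P : Pred B p} (P? : Decidable P) (g : A → B) xs →
            count P? (map g xs) ≡ count (P? ∘ g) xs
count-map P? g [] = refl
count-map P? g (x ∷ xs) with does (P? (g x))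
... | true = cong suc (count-map P? g xs)
... | false = count-map P? g xs

count-cartesianProduct : ∀ {a p} {A : Set a} {P : Pred (A × A) p} (P? : Decidable P) (xs ys : List A) →
                         count P? (cartesianProduct xs ys) ≡ sum (map (λ x → count (λ y → P? (x , y)) ys) xs)
count-cartesianProduct P? [] ys = refl
count-cartesianProduct P? (x ∷ xs) ys = begin
    length (filter P? (map (x ,_) ys ++ cartesianProduct xs ys))       ≡⟨ cong length (filter-++ P? (map (x ,_) ys) _) ⟩
    length (filter P? (map (x ,_) ys) ++ filter P? (cartesianProduct xs ys)) ≡⟨ length-++ (filter P? (map (x ,_) ys)) ⟩
    count P? (map (x ,_) ys) + count P? (cartesianProduct xs ys)       ≡⟨ cong₂ _+_ (count-map P? (x ,_) ys) (count-cartesianProduct P? xs ys) ⟩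
    count (λ y → P? (x , y)) ys + sum (map (λ x → count (λ y → P? (x , y)) ys) xs) ∎
  where open ≡-Reasoning

⟦_⟧ : ∀ {n} → Permutation′ n → ℕ → ℕ
⟦ π ⟧ = extend (λ k → toℕ (π ⟨$⟩ʳ k))

⟦⟧-toℕ : ∀ {n} (π : Permutation′ n) k → ⟦ π ⟧ (toℕ k) ≡ toℕ (π ⟨$⟩ʳ k)
⟦⟧-toℕ π = extend-toℕ _

⟦⟧-< : ∀ {n} (π : Permutation′ n) {k} (k<n : k < n) → ⟦ π ⟧ k ≡ toℕ (π ⟨$⟩ʳ fromℕ< k<n)
⟦⟧-< π = extend-< _

⟦⟧-IsPermutation : ∀ {n} (π : Permutation′ n) → IsPermutation n ⟦ π ⟧
⟦⟧-IsPermutation {n} π = record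
  { bounded    = λ k k<n → subst (_< n) (sym (⟦⟧-< π k<n)) (toℕ<n _)
  ; injective  = injective
  ; surjective = λ v v<n → toℕ (π ⟨$⟩ˡ fromℕ< v<n) , toℕ<n _
                         , trans (⟦⟧-toℕ π _) (trans (cong toℕ (inverseʳ π)) (toℕ-fromℕ< v<n))
  }
  where
  injective : ∀ p q → p < n → q < n → ⟦ π ⟧ p ≡ ⟦ π ⟧ q → p ≡ q
  injective p q p<n q<n eq = begin
    p                                    ≡⟨ sym (toℕ-fromℕ< p<n) ⟩
    toℕ (fromℕ< p<n)                     ≡⟨ cong toℕ (sym (inverseˡ π)) ⟩
    toℕ (π ⟨$⟩ˡ (π ⟨$⟩ʳ fromℕ< p<n))      ≡⟨ cong (λ x → toℕ (π ⟨$⟩ˡ x)) (toℕ-injective (trans (sym (⟦⟧-< π p<n)) (trans eq (⟦⟧-< π q<n)))) ⟩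
    toℕ (π ⟨$⟩ˡ (π ⟨$⟩ʳ fromℕ< q<n))      ≡⟨ cong toℕ (inverseˡ π) ⟩
    toℕ (fromℕ< q<n)                     ≡⟨ toℕ-fromℕ< q<n ⟩
    q ∎
    where open ≡-Reasoning

⟦⟧-· : ∀ {n} (u v : Permutation′ n) {k} → k < n → ⟦ u · v ⟧ k ≡ ⟦ u ⟧ (⟦ v ⟧ k)
⟦⟧-· u v k<n = trans (⟦⟧-< (u · v) k<n) (trans (sym (⟦⟧-toℕ u _)) (cong ⟦ u ⟧ (sym (⟦⟧-< v k<n))))

≈⇒⟦⟧-≡ : ∀ {n} (u v : Permutation′ n) → u ≈ v → ∀ k → k < n → ⟦ u ⟧ k ≡ ⟦ v ⟧ k
≈⇒⟦⟧-≡ u v u≈v k k<n = trans (⟦⟧-< u k<n) (trans (cong toℕ (u≈v _)) (sym (⟦⟧-< v k<n)))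

⟦⟧-≡⇒≈ : ∀ {n} (u v : Permutation′ n) → (∀ k → k < n → ⟦ u ⟧ k ≡ ⟦ v ⟧ k) → u ≈ v
⟦⟧-≡⇒≈ u v u≗v x = toℕ-injective (trans (sym (⟦⟧-toℕ u x)) (trans (u≗v (toℕ x) (toℕ<n x)) (⟦⟧-toℕ v x)))

⟦transpose⟧ : ∀ {n} (i j : Fin n) {k} → k < n → ⟦ transpose i j ⟧ k ≡ swap (toℕ i) (toℕ j) k
⟦transpose⟧ i j {k} k<n = trans (⟦⟧-< (transpose i j) k<n) (trans (toℕ-transpose (fromℕ< k<n)) (cong (swap (toℕ i) (toℕ j)) (toℕ-fromℕ< k<n)))
  where
  toℕ-transpose : ∀ x → toℕ (PC.transpose i j x) ≡ swap (toℕ i) (toℕ j) (toℕ x)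
  toℕ-transpose x with x Fin.≟ i
  ... | yes refl = sym (swap-first (toℕ x) (toℕ j))
  ... | no x≢i with x Fin.≟ j
  ...   | yes refl = sym (swap-second (toℕ i) (toℕ x))
  ...   | no x≢j = sym (swap-other _ _ _ (x≢i ∘ toℕ-injective) (x≢j ∘ toℕ-injective))

⟦·transpose⟧ : ∀ {n} (w : Permutation′ n) (i j : Fin n) {k} → k < n → ⟦ w · transpose i j ⟧ k ≡ ⟦ w ⟧ (swap (toℕ i) (toℕ j) k)
⟦·transpose⟧ w i j k<n = trans (⟦⟧-· w (transpose i j) k<n) (cong ⟦ w ⟧ (⟦transpose⟧ i j k<n))

⟦id⟧ : ∀ {n k} → k < n → ⟦ Perm.id {n} ⟧ k ≡ k
⟦id⟧ k<n = trans (⟦⟧-< Perm.id k<n) (toℕ-fromℕ< k<n)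

codeEntry≡codeAt : ∀ {n} (w : Permutation′ n) i → codeEntry w i ≡ codeAt n ⟦ w ⟧ (toℕ i)
codeEntry≡codeAt {n} w i = begin
    codeEntry w i                                ≡⟨ count-tabulate P? (λ k → k) ⟩
    ∑ (extend (λ k → if does (P? k) then 1 else 0)) 0 n ≡⟨ ∑-cong _ laterBelow {0} n (λ l _ l<n → trans (extend-< _ l<n) (trans (pointwise (fromℕ< l<n)) (cong laterBelow (toℕ-fromℕ< l<n)))) ⟩
    ∑ laterBelow 0 n                             ≡⟨ ∑-split laterBelow n z≤n (toℕ<n i) ⟩
    ∑ laterBelow 0 (suc (toℕ i)) + ∑ laterBelow (suc (toℕ i)) n
      ≡⟨ cong₂ _+_ (trans (∑-cong laterBelow (λ _ → 0) {0} (suc (toℕ i)) (λ l _ l<1+i → cong (if_then below l else 0) (dec-false (toℕ i <? l) (≤⇒≯ (≤-pred l<1+i)))))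
                          (∑-zeros 0 (suc (toℕ i))))
                   (∑-cong laterBelow below {suc (toℕ i)} n (λ l i<l _ → cong (if_then below l else 0) (dec-true (toℕ i <? l) i<l))) ⟩
    codeAt n ⟦ w ⟧ (toℕ i) ∎
  where
  open ≡-Reasoning
  P? : Decidable (λ k → toℕ i < toℕ k × toℕ (w ⟨$⟩ʳ k) < toℕ (w ⟨$⟩ʳ i))
  P? k = (toℕ i <? toℕ k) ×-dec (toℕ (w ⟨$⟩ʳ k) <? toℕ (w ⟨$⟩ʳ i))
  below laterBelow : ℕ → ℕ
  below l = [ ⟦ w ⟧ l < ⟦ w ⟧ (toℕ i) ]
  laterBelow l = if does (toℕ i <? l) then below l else 0
  pointwise : ∀ k → (if does (P? k) then 1 else 0) ≡ laterBelow (toℕ k)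
  pointwise k rewrite ⟦⟧-toℕ w k | ⟦⟧-toℕ w i with toℕ i <ᵇ toℕ k
  ... | true = refl
  ... | false = refl

ℓ≡∑code : ∀ {m} (w : Permutation′ (suc m)) → ℓ w ≡ ∑ (codeAt (suc m) ⟦ w ⟧) 0 (suc m)
ℓ≡∑code {m} w = begin
    ℓ w                                  ≡⟨ count-cartesianProduct inversion? (allFin n) (allFin n) ⟩
    sum (map (codeEntry w) (allFin n))   ≡⟨ cong sum (map-tabulate (λ x → x) (codeEntry w)) ⟩
    sum (tabulate (codeEntry w))         ≡⟨ sum-tabulate (codeEntry w) ⟩
    ∑ (extend (codeEntry w)) 0 n         ≡⟨ ∑-cong _ (codeAt n ⟦ w ⟧) {0} n (λ l _ l<n → trans (extend-< (codeEntry w) l<n) (trans (codeEntry≡codeAt w _) (cong (codeAt n ⟦ w ⟧) (toℕ-fromℕ< l<n)))) ⟩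
    ∑ (codeAt n ⟦ w ⟧) 0 n ∎
  where
  open ≡-Reasoning
  n : ℕ
  n = suc m
  inversion? : Decidable (λ (p : Fin n × Fin n) → toℕ (proj₁ p) < toℕ (proj₂ p) × toℕ (w ⟨$⟩ʳ proj₂ p) < toℕ (w ⟨$⟩ʳ proj₁ p))
  inversion? p = (toℕ (proj₁ p) <? toℕ (proj₂ p)) ×-dec (toℕ (w ⟨$⟩ʳ proj₂ p) <? toℕ (w ⟨$⟩ʳ proj₁ p))

code-CodeOf : ∀ {m} (w : Permutation′ (suc m)) → CodeOf (suc m) ⟦ w ⟧ (code w)
code-CodeOf {m} w = record { at-code = at-code ; weight-code = weight-code }
  where
  n : ℕ
  n = suc m
  entries : Fin m → ℕ
  entries i = codeEntry w (inject₁ i)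
  code≡tabulate : code w ≡ tabulate entries
  code≡tabulate = map-tabulate (λ x → x) entries
  codeAt-last : ∀ k → m ≤ k → codeAt n ⟦ w ⟧ k ≡ 0
  codeAt-last k m≤k = ∑-empty _ n (s≤s m≤k)
  at-code : ∀ k → at (code w) (suc k) ≡ codeAt n ⟦ w ⟧ k
  at-code k = trans (cong (λ α → at α (suc k)) code≡tabulate) (trans (at-tabulate entries k) (byRange (k <? m)))
    where
    byRange : Dec (k < m) → extend entries k ≡ codeAt n ⟦ w ⟧ k
    byRange (yes k<m) = trans (extend-inject₁ (codeEntry w) k k<m)
                              (trans (extend-< _ (m≤n⇒m≤1+n k<m)) (trans (codeEntry≡codeAt w _) (cong (codeAt n ⟦ w ⟧) (toℕ-fromℕ< _))))
    byRange (no k≮m) = trans (extend-≥ entries k (≮⇒≥ k≮m)) (sym (codeAt-last k (≮⇒≥ k≮m)))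
  weight-code : weight (code w) ≡ ∑ (codeAt n ⟦ w ⟧) 0 n
  weight-code = begin
    sum (code w)                         ≡⟨ cong sum code≡tabulate ⟩
    sum (tabulate entries)               ≡⟨ sum-tabulate entries ⟩
    ∑ (extend entries) 0 m               ≡⟨ ∑-cong _ _ m (λ l _ _ → trans (sym (at-tabulate entries l)) (trans (cong (λ α → at α (suc l)) (sym code≡tabulate)) (at-code l))) ⟩
    ∑ (codeAt n ⟦ w ⟧) 0 m               ≡⟨ sym (+-identityʳ _) ⟩
    ∑ (codeAt n ⟦ w ⟧) 0 m + 0           ≡⟨ cong (∑ (codeAt n ⟦ w ⟧) 0 m +_) (sym (codeAt-last m ≤-refl)) ⟩
    ∑ (codeAt n ⟦ w ⟧) 0 m + codeAt n ⟦ w ⟧ m ≡⟨ sym (∑-extend (codeAt n ⟦ w ⟧) z≤n) ⟩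
    ∑ (codeAt n ⟦ w ⟧) 0 n ∎
    where open ≡-Reasoning

adjacent-descent : ∀ (W : ℕ → ℕ) {i j} → i < j → W j < W i → Σ ℕ λ a → i ≤ a × a < j × W (suc a) < W a
adjacent-descent W {i} {suc j} i<1+j W1+j<Wi with W (suc j) <? W j
... | yes desc = j , ≤-pred i<1+j , ≤-refl , desc
... | no ¬desc with m≤n⇒m<n∨m≡n (≤-pred i<1+j)
...   | inj₂ refl = contradiction W1+j<Wi ¬desc
...   | inj₁ i<j with adjacent-descent W i<j (≤-<-trans (≮⇒≥ ¬desc) W1+j<Wi)
...     | a , i≤a , a<j , desc = a , i≤a , m≤n⇒m≤1+n a<j , desc

data SwapCase (a k : ℕ) : Set where
  at-a      : k ≡ a → swap a (suc a) k ≡ suc a → SwapCase a k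
  at-suc-a  : k ≡ suc a → swap a (suc a) k ≡ a → SwapCase a k
  elsewhere : k ≢ a → k ≢ suc a → swap a (suc a) k ≡ k → SwapCase a k

swapCase : ∀ a k → SwapCase a k
swapCase a k with k ≟ a | k ≟ suc a
... | yes refl | _ = at-a refl (swap-first k (suc k))
... | no _ | yes refl = at-suc-a refl (swap-second a k)
... | no k≢a | no k≢1+a = elsewhere k≢a k≢1+a (swap-other a (suc a) k k≢a k≢1+a)

module AdjacentRelabel {i j a} (i<j : i < j) (i≤a : i ≤ a) (a<j : a < j) (not-ij : ¬ (a ≡ i × suc a ≡ j)) where
  σ : ℕ → ℕ
  σ = swap a (suc a)

  i≤σi : i ≤ σ i
  i≤σi with swapCase a i
  ... | at-a _ σi≡1+a = subst (i ≤_) (sym σi≡1+a) (m≤n⇒m≤1+n i≤a)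
  ... | at-suc-a i≡1+a _ = contradiction (subst (a <_) (sym i≡1+a) (n<1+n a)) (≤⇒≯ i≤a)
  ... | elsewhere _ _ σi≡i = ≤-reflexive (sym σi≡i)

  σj≤j : σ j ≤ j
  σj≤j with swapCase a j
  ... | at-a j≡a _ = contradiction (sym j≡a) (<⇒≢ a<j)
  ... | at-suc-a _ σj≡a = subst (_≤ j) (sym σj≡a) (<⇒≤ a<j)
  ... | elsewhere _ _ σj≡j = ≤-reflexive σj≡j

  σi<σj : σ i < σ j
  σi<σj with swapCase a i | swapCase a j
  ... | at-suc-a i≡1+a _ | _ = contradiction (subst (a <_) (sym i≡1+a) (n<1+n a)) (≤⇒≯ i≤a)
  ... | _ | at-a j≡a _ = contradiction (sym j≡a) (<⇒≢ a<j)
  ... | at-a i≡a _ | at-suc-a j≡1+a _ = contradiction (sym i≡a , sym j≡1+a) not-ij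
  ... | at-a _ σi≡1+a | elsewhere _ j≢1+a σj≡j = subst₂ _<_ (sym σi≡1+a) (sym σj≡j) (≤∧≢⇒< a<j (j≢1+a ∘ sym))
  ... | elsewhere i≢a _ σi≡i | at-suc-a _ σj≡a = subst₂ _<_ (sym σi≡i) (sym σj≡a) (≤∧≢⇒< i≤a i≢a)
  ... | elsewhere _ _ σi≡i | elsewhere _ _ σj≡j = subst₂ _<_ (sym σi≡i) (sym σj≡j) i<j

  σ-between : ∀ k → σ i < k → k < σ j → i < σ k × σ k < j
  σ-between k σi<k k<σj with swapCase a k
  ... | at-a k≡a σk≡1+a = subst (i <_) (sym σk≡1+a) (s≤s i≤a) , subst (_< j) (sym σk≡1+a) 1+a<j
    where
    1+a<j : suc a < j
    1+a<j with swapCase a j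
    ... | at-a j≡a _ = contradiction (sym j≡a) (<⇒≢ a<j)
    ... | at-suc-a _ σj≡a = contradiction (subst₂ _<_ k≡a σj≡a k<σj) (n≮n a)
    ... | elsewhere _ j≢1+a _ = ≤∧≢⇒< a<j (j≢1+a ∘ sym)
  ... | at-suc-a k≡1+a σk≡a = subst (i <_) (sym σk≡a) i<a , subst (_< j) (sym σk≡a) a<j
    where
    i<a : i < a
    i<a with swapCase a i
    ... | at-a _ σi≡1+a = contradiction (subst₂ _<_ σi≡1+a k≡1+a σi<k) (n≮n (suc a))
    ... | at-suc-a i≡1+a _ = contradiction (subst (a <_) (sym i≡1+a) (n<1+n a)) (≤⇒≯ i≤a)
    ... | elsewhere i≢a _ _ = ≤∧≢⇒< i≤a i≢a
  ... | elsewhere _ _ σk≡k = subst (i <_) (sym σk≡k) (≤-<-trans i≤σi σi<k) , subst (_< j) (sym σk≡k) (<-≤-trans k<σj σj≤j)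

prod-snoc : ∀ {m} (xs : List (Fin m)) a → prod (xs ++ a ∷ []) ≈ (prod xs · s a)
prod-snoc [] a k = refl
prod-snoc (x ∷ xs) a k = cong (s x ⟨$⟩ʳ_) (prod-snoc xs a k)

⟦s⟧ : ∀ {m a} (a<m : a < m) {k} → k < suc m → ⟦ s (fromℕ< a<m) ⟧ k ≡ swap a (suc a) k
⟦s⟧ a<m {k} k<n = trans (⟦transpose⟧ _ _ k<n)
                        (cong₂ (λ x y → swap x y k) (trans (toℕ-inject₁ _) (toℕ-fromℕ< a<m)) (cong suc (toℕ-fromℕ< a<m)))

⟦·s⟧ : ∀ {m} (w : Permutation′ (suc m)) {a} (a<m : a < m) {k} → k < suc m →
       ⟦ w · s (fromℕ< a<m) ⟧ k ≡ ⟦ w ⟧ (swap a (suc a) k)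
⟦·s⟧ w a<m k<n = trans (⟦⟧-· w (s (fromℕ< a<m)) k<n) (cong ⟦ w ⟧ (⟦s⟧ a<m k<n))

ℓ-descent : ∀ {m} (w : Permutation′ (suc m)) {a} (a<m : a < m) → ⟦ w ⟧ (suc a) < ⟦ w ⟧ a →
            ℓ w ≡ suc (ℓ (w · s (fromℕ< a<m)))
ℓ-descent {m} w {a} a<m desc = begin
    ℓ w                                           ≡⟨ ℓ≡∑code w ⟩
    ∑ (codeAt n ⟦ w ⟧) 0 n                        ≡⟨ gap≡0⇒∑code≡+1 (∑-empty _ (suc a) ≤-refl) ⟩
    ∑ (codeAt n ⟦ w · s (fromℕ< a<m) ⟧) 0 n + 1   ≡⟨ +-comm _ 1 ⟩
    suc (∑ (codeAt n ⟦ w · s (fromℕ< a<m) ⟧) 0 n) ≡⟨ cong suc (sym (ℓ≡∑code (w · s (fromℕ< a<m)))) ⟩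
    suc (ℓ (w · s (fromℕ< a<m))) ∎
  where
  open ≡-Reasoning
  n : ℕ
  n = suc m
  open TranspositionCode n ⟦ w ⟧ ⟦ w · s (fromℕ< a<m) ⟧ (⟦⟧-IsPermutation w) a (suc a) (n<1+n a) (s≤s a<m) desc
                         (λ k k<n → ⟦·s⟧ w a<m k<n) using (gap≡0⇒∑code≡+1)

Reduced-snoc : ∀ {m} (w : Permutation′ (suc m)) {a} (a<m : a < m) → ⟦ w ⟧ (suc a) < ⟦ w ⟧ a →
               ∀ us → Reduced us (w · s (fromℕ< a<m)) → Reduced (us ++ fromℕ< a<m ∷ []) w
Reduced-snoc {m} w {a} a<m desc us (us≈ , length-us) = ⟦⟧-≡⇒≈ (prod (us ++ sₐ ∷ [])) w same , same-length
  where
  sₐ : Fin m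
  sₐ = fromℕ< a<m
  same : ∀ k → k < suc m → ⟦ prod (us ++ sₐ ∷ []) ⟧ k ≡ ⟦ w ⟧ k
  same k k<n = begin
    ⟦ prod (us ++ sₐ ∷ []) ⟧ k                ≡⟨ ≈⇒⟦⟧-≡ (prod (us ++ sₐ ∷ [])) (prod us · s sₐ) (prod-snoc us sₐ) k k<n ⟩
    ⟦ prod us · s sₐ ⟧ k                      ≡⟨ ⟦·s⟧ (prod us) a<m k<n ⟩
    ⟦ prod us ⟧ (swap a (suc a) k)            ≡⟨ ≈⇒⟦⟧-≡ (prod us) (w · s sₐ) us≈ _ σk<n ⟩
    ⟦ w · s sₐ ⟧ (swap a (suc a) k)           ≡⟨ ⟦·s⟧ w a<m σk<n ⟩
    ⟦ w ⟧ (swap a (suc a) (swap a (suc a) k)) ≡⟨ cong ⟦ w ⟧ (swap-involutive a (suc a) k) ⟩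
    ⟦ w ⟧ k ∎
    where
    open ≡-Reasoning
    σk<n : swap a (suc a) k < suc m
    σk<n = swap-< a (suc a) k (<-trans (n<1+n a) (s≤s a<m)) (s≤s a<m) k<n
  same-length : length (us ++ sₐ ∷ []) ≡ ℓ w
  same-length = trans (length-++ us) (trans (cong (_+ 1) length-us) (trans (+-comm _ 1) (sym (ℓ-descent w a<m desc))))

ℓ≢0⇒descent : ∀ {m} (w : Permutation′ (suc m)) → ℓ w ≢ 0 → Σ ℕ λ a → a < m × ⟦ w ⟧ (suc a) < ⟦ w ⟧ a
ℓ≢0⇒descent {m} w ℓ≢0 with ∑≢0⇒ (codeAt (suc m) ⟦ w ⟧) 0 (suc m) (ℓ≢0 ∘ trans (ℓ≡∑code w))
... | k , _ , k<n , code≢0 with ∑≢0⇒ _ (suc k) (suc m) code≢0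
...   | l , k<l , l<n , [Wl<Wk]≢0 with adjacent-descent ⟦ w ⟧ k<l Wl<Wk
  where
  Wl<Wk : ⟦ w ⟧ l < ⟦ w ⟧ k
  Wl<Wk with ⟦ w ⟧ l <? ⟦ w ⟧ k
  ... | yes Wl<Wk = Wl<Wk
  ... | no Wl≮Wk = contradiction (≮⇒[<]≡0 Wl≮Wk) [Wl<Wk]≢0
...     | a , _ , a<l , desc = a , <-≤-trans a<l (≤-pred l<n) , desc

reducedWord : ∀ {m} N (w : Permutation′ (suc m)) → ℓ w ≡ N → Σ (List (Fin m)) λ ws → Reduced ws w
reducedWord {m} zero w ℓ≡0 = [] , ⟦⟧-≡⇒≈ Perm.id w (code-injective (⟦⟧-IsPermutation Perm.id) (⟦⟧-IsPermutation w) sameCode) , sym ℓ≡0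
  where
  n : ℕ
  n = suc m
  sameCode : ∀ k → k < n → codeAt n ⟦ Perm.id {n} ⟧ k ≡ codeAt n ⟦ w ⟧ k
  sameCode k k<n = trans (trans (∑-cong _ (λ _ → 0) {suc k} n (λ l k<l l<n → trans (cong₂ [_<_] (⟦id⟧ l<n) (⟦id⟧ k<n)) (≮⇒[<]≡0 (<⇒≯ k<l))))
                                (∑-zeros (suc k) n))
                         (sym (∑≡0⇒ (codeAt n ⟦ w ⟧) n (trans (sym (ℓ≡∑code w)) ℓ≡0) k z≤n k<n))
reducedWord (suc N) w ℓ≡1+N =
  let a , a<m , desc = ℓ≢0⇒descent w (λ ℓ≡0 → 1+n≢0 (trans (sym ℓ≡1+N) ℓ≡0))
      us , reduced = reducedWord N (w · s (fromℕ< a<m)) (suc-injective (trans (sym (ℓ-descent w a<m desc)) ℓ≡1+N))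
  in us ++ fromℕ< a<m ∷ [] , Reduced-snoc w a<m desc us reduced

≤B-resp-≈ : ∀ {m} (u v w : Permutation′ (suc m)) → u ≈ v → u ≤B w → v ≤B w
≤B-resp-≈ u v w u≈v (ws , reduced , vs , vs⊆ws , vs≈u) = ws , reduced , vs , vs⊆ws , λ k → trans (vs≈u k) (u≈v k)

descent-≤B : ∀ {m} (w : Permutation′ (suc m)) {a} (a<m : a < m) → ⟦ w ⟧ (suc a) < ⟦ w ⟧ a →
             (w · s (fromℕ< a<m)) ≤B w
descent-≤B w a<m desc with reducedWord _ (w · s (fromℕ< a<m)) refl
... | us , reduced = us ++ fromℕ< a<m ∷ [] , Reduced-snoc w a<m desc us reduced , us , ++⁺ʳ (fromℕ< a<m ∷ []) ⊆-refl , proj₁ reduced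

≤B-lift : ∀ {m} (w : Permutation′ (suc m)) {a} (a<m : a < m) → ⟦ w ⟧ (suc a) < ⟦ w ⟧ a →
          ∀ v → v ≤B (w · s (fromℕ< a<m)) → (v · s (fromℕ< a<m)) ≤B w
≤B-lift w a<m desc v (ws , reduced , vs , vs⊆ws , vs≈v) =
  ws ++ sₐ ∷ [] , Reduced-snoc w a<m desc ws reduced , vs ++ sₐ ∷ [] , ++⁺ vs⊆ws ⊆-refl , λ k → trans (prod-snoc vs sₐ k) (vs≈v _)
  where sₐ = fromℕ< a<m

module Relabel {m} (w : Permutation′ (suc m)) {i j : Fin (suc m)} {a} (a<m : a < m)
               (i≤a : toℕ i ≤ a) (a<j : a < toℕ j) (i<j : toℕ i < toℕ j) (not-ij : ¬ (a ≡ toℕ i × suc a ≡ toℕ j)) where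
  open AdjacentRelabel i<j i≤a a<j not-ij using (σi<σj; σ-between)

  n : ℕ
  n = suc m

  sₐ : Fin m
  sₐ = fromℕ< a<m

  u : Permutation′ n
  u = w · s sₐ

  σ : ℕ → ℕ
  σ = swap a (suc a)

  σ-< : ∀ {k} → k < n → σ k < n
  σ-< {k} = swap-< a (suc a) k (<-trans (n<1+n a) (s≤s a<m)) (s≤s a<m)

  i′ j′ : Fin n
  i′ = fromℕ< (σ-< (toℕ<n i))
  j′ = fromℕ< (σ-< (toℕ<n j))

  i′<j′ : toℕ i′ < toℕ j′
  i′<j′ = subst₂ _<_ (sym (toℕ-fromℕ< (σ-< (toℕ<n i)))) (sym (toℕ-fromℕ< (σ-< (toℕ<n j)))) σi<σj

  ⟦u⟧-σ : ∀ (x : Fin n) → ⟦ u ⟧ (toℕ (fromℕ< (σ-< (toℕ<n x)))) ≡ ⟦ w ⟧ (toℕ x)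
  ⟦u⟧-σ x = trans (cong ⟦ u ⟧ (toℕ-fromℕ< (σ-< (toℕ<n x)))) (trans (⟦·s⟧ w a<m (σ-< (toℕ<n x))) (cong ⟦ w ⟧ (swap-involutive a (suc a) (toℕ x))))

  descent′ : ⟦ w ⟧ (toℕ j) < ⟦ w ⟧ (toℕ i) → ⟦ u ⟧ (toℕ j′) < ⟦ u ⟧ (toℕ i′)
  descent′ = subst₂ _<_ (sym (⟦u⟧-σ j)) (sym (⟦u⟧-σ i))

  noValue′ : NoValueBetween ⟦ w ⟧ (toℕ i) (toℕ j) → NoValueBetween ⟦ u ⟧ (toℕ i′) (toℕ j′)
  noValue′ noValue k i′<k k<j′ (Uj′<Uk , Uk<Ui′) =
    noValue (σ k) (proj₁ inside) (proj₂ inside)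
            (subst₂ _<_ (⟦u⟧-σ j) Uk≡ Uj′<Uk , subst₂ _<_ Uk≡ (⟦u⟧-σ i) Uk<Ui′)
    where
    inside : toℕ i < σ k × σ k < toℕ j
    inside = σ-between k (subst (_< k) (toℕ-fromℕ< (σ-< (toℕ<n i))) i′<k) (subst (k <_) (toℕ-fromℕ< (σ-< (toℕ<n j))) k<j′)
    Uk≡ : ⟦ u ⟧ k ≡ ⟦ w ⟧ (σ k)
    Uk≡ = ⟦·s⟧ w a<m (<-trans k<j′ (toℕ<n j′))

  relabel : ((u · transpose i′ j′) · s sₐ) ≈ (w · transpose i j)
  relabel = ⟦⟧-≡⇒≈ ((u · transpose i′ j′) · s sₐ) (w · transpose i j) same
    where
    same : ∀ k → k < n → ⟦ (u · transpose i′ j′) · s sₐ ⟧ k ≡ ⟦ w · transpose i j ⟧ k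
    same k k<n = begin
      ⟦ (u · transpose i′ j′) · s sₐ ⟧ k                ≡⟨ ⟦·s⟧ (u · transpose i′ j′) a<m k<n ⟩
      ⟦ u · transpose i′ j′ ⟧ (σ k)                     ≡⟨ ⟦·transpose⟧ u i′ j′ (σ-< k<n) ⟩
      ⟦ u ⟧ (swap (toℕ i′) (toℕ j′) (σ k))              ≡⟨ cong₂ (λ x y → ⟦ u ⟧ (swap x y (σ k))) (toℕ-fromℕ< _) (toℕ-fromℕ< _) ⟩
      ⟦ u ⟧ (swap (σ (toℕ i)) (σ (toℕ j)) (σ k))        ≡⟨ ⟦·s⟧ w a<m (swap-< _ _ _ (σ-< (toℕ<n i)) (σ-< (toℕ<n j)) (σ-< k<n)) ⟩
      ⟦ w ⟧ (σ (swap (σ (toℕ i)) (σ (toℕ j)) (σ k)))    ≡⟨ cong ⟦ w ⟧ (swap-conjugate a (suc a) (toℕ i) (toℕ j) k) ⟩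
      ⟦ w ⟧ (swap (toℕ i) (toℕ j) k)                    ≡⟨ sym (⟦·transpose⟧ w i j k<n) ⟩
      ⟦ w · transpose i j ⟧ k ∎
      where open ≡-Reasoning

transposition≤B : ∀ {m} N (w : Permutation′ (suc m)) (i j : Fin (suc m)) → ℓ w ≡ N → toℕ i < toℕ j →
                  ⟦ w ⟧ (toℕ j) < ⟦ w ⟧ (toℕ i) → NoValueBetween ⟦ w ⟧ (toℕ i) (toℕ j) → (w · transpose i j) ≤B w
transposition≤B {m} N w i j ℓ≡N i<j Wj<Wi noValue with adjacent-descent ⟦ w ⟧ i<j Wj<Wi
... | a , i≤a , a<j , desc = byCase N ℓ≡N ((a ≟ toℕ i) ×-dec (suc a ≟ toℕ j))
  where
  a<m : a < m
  a<m = <-≤-trans a<j (≤-pred (toℕ<n j))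
  byCase : ∀ N → ℓ w ≡ N → Dec (a ≡ toℕ i × suc a ≡ toℕ j) → (w · transpose i j) ≤B w
  byCase zero ℓ≡0 _ = contradiction (trans (sym (ℓ-descent w a<m desc)) ℓ≡0) 1+n≢0
  byCase (suc N) ℓ≡1+N (yes (a≡i , 1+a≡j)) =
    ≤B-resp-≈ (w · s (fromℕ< a<m)) (w · transpose i j) w (⟦⟧-≡⇒≈ (w · s (fromℕ< a<m)) (w · transpose i j) same) (descent-≤B w a<m desc)
    where
    same : ∀ k → k < suc m → ⟦ w · s (fromℕ< a<m) ⟧ k ≡ ⟦ w · transpose i j ⟧ k
    same k k<n = trans (⟦·s⟧ w a<m k<n) (trans (cong₂ (λ x y → ⟦ w ⟧ (swap x y k)) a≡i 1+a≡j) (sym (⟦·transpose⟧ w i j k<n)))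
  byCase (suc N) ℓ≡1+N (no not-ij) =
    ≤B-resp-≈ ((u · transpose i′ j′) · s sₐ) (w · transpose i j) w relabel
              (≤B-lift w a<m desc (u · transpose i′ j′) (transposition≤B N u i′ j′ ℓu i′<j′ (descent′ Wj<Wi) (noValue′ noValue)))
    where
    open Relabel w a<m i≤a a<j i<j not-ij
    ℓu : ℓ u ≡ N
    ℓu = suc-injective (trans (sym (ℓ-descent w a<m desc)) ℓ≡1+N)

theorem4p3 : (m : ℕ) (w w' : Permutation′ (suc m)) (i j : Fin (suc m)) → toℕ i < toℕ j →
    ((w Covers w') × (w' ≈ (w · transpose i j)))
      ⇔ CoversIn (code w) (code w') (toℕ i + 1) (toℕ j + 1)
theorem4p3 m w w' i j i<j = mk⇔
  (λ ((_ , ℓ-drop) , w'≈) → +1⇒suc (transposition-drop⇒CoversIn (w'≈⇒⟦w'⟧≗ w'≈) (ℓ⇒∑code ℓ-drop)))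
  (λ cov → let cov′ = suc⇒+1 cov
               (noValue , ⟦w'⟧≗) = CoversIn⇒transposition cov′
               w'≈ = ⟦⟧-≡⇒≈ w' (w · transpose i j) (λ k k<n → trans (⟦w'⟧≗ k k<n) (sym (⟦·transpose⟧ w i j k<n)))
           in ((≤B-resp-≈ (w · transpose i j) w' w (λ k → sym (w'≈ k)) (transposition≤B (ℓ w) w i j refl i<j (CoversIn⇒descent cov′) noValue)
              , ∑code⇒ℓ (CoversIn⇒∑code-drop cov′))
              , w'≈))
  where
  open Cover (⟦⟧-IsPermutation w) (⟦⟧-IsPermutation w') (code-CodeOf w) (code-CodeOf w') i<j (toℕ<n j)
  +1⇒suc : CoversIn (code w) (code w') (suc (toℕ i)) (suc (toℕ j)) → CoversIn (code w) (code w') (toℕ i + 1) (toℕ j + 1)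
  +1⇒suc = subst₂ (CoversIn (code w) (code w')) (+-comm 1 (toℕ i)) (+-comm 1 (toℕ j))
  suc⇒+1 : CoversIn (code w) (code w') (toℕ i + 1) (toℕ j + 1) → CoversIn (code w) (code w') (suc (toℕ i)) (suc (toℕ j))
  suc⇒+1 = subst₂ (CoversIn (code w) (code w')) (+-comm (toℕ i) 1) (+-comm (toℕ j) 1)
  w'≈⇒⟦w'⟧≗ : w' ≈ (w · transpose i j) → ∀ k → k < suc m → ⟦ w' ⟧ k ≡ ⟦ w ⟧ (swap (toℕ i) (toℕ j) k)
  w'≈⇒⟦w'⟧≗ w'≈ k k<n = trans (≈⇒⟦⟧-≡ w' (w · transpose i j) w'≈ k k<n) (⟦·transpose⟧ w i j k<n)
  ℓ⇒∑code : ℓ w ≡ ℓ w' + 1 → ∑ (codeAt (suc m) ⟦ w ⟧) 0 (suc m) ≡ ∑ (codeAt (suc m) ⟦ w' ⟧) 0 (suc m) + 1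
  ℓ⇒∑code ℓ-drop = trans (sym (ℓ≡∑code w)) (trans ℓ-drop (cong (_+ 1) (ℓ≡∑code w')))
  ∑code⇒ℓ : ∑ (codeAt (suc m) ⟦ w ⟧) 0 (suc m) ≡ ∑ (codeAt (suc m) ⟦ w' ⟧) 0 (suc m) + 1 → ℓ w ≡ ℓ w' + 1
  ∑code⇒ℓ drop = trans (ℓ≡∑code w) (trans drop (cong (_+ 1) (sym (ℓ≡∑code w'))))
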